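{- Let $M\in\Lambda^L$, let $M=_{\beta^L}M'$, and let $\Gamma\Vdash_L M:\sigma$. Then $\Gamma\Vdash_L M':\sigma$ (with equality of environments and types understood up to renaming of type variables).
   Context: $\Lambda^L$ (strictly linear $\lambda$-terms): terms built from variables and constants by application and abstraction $\lambda x.M$ allowed only when $x$ occurs free in $M$ exactly once. $=_{\beta^L}$ is the provable equality generated by $(\lambda x.M)N=M[N/x]$, the rule "from $M=N$ with $x$ free exactly once in $M$ and in $N$ infer $\lambda x.M=\lambda x.N$", and the congruence rules. Simple types: $\mu::=\alpha\mid\mu\to\mu$ with $\alpha$ type variables. Environments $\Gamma$ are sets $x_1:\mu_1,\dots,x_m:\mu_m$ with distinct variables. Principal type schemes $\Vdash_L$: $x:\alpha\Vdash_L x:\alpha$; if $x\in FV(M)$ and $\Gamma,x:\mu\Vdash_L M:\nu$ then $\Gamma\Vdash_L\lambda x.M:\mu\to\nu$; if $\Gamma\Vdash_L M:\mu$, $\Delta\Vdash_L N:\tau$, $\mathrm{dom}(\Gamma)\cap\mathrm{dom}(\Delta)=\emptyset$, the type variables of $\Gamma,\Delta$ are disjoint and those of $\mu,\tau$ are disjoint, $\alpha,\beta$ fresh, $U'=MGU(\mu,\alpha\to\beta)$, $U=MGU(U'(\alpha),\tau)$, then $U(\Gamma,\Delta)\Vdash_L MN:U\circ U'(\beta)$, where $MGU$ denotes the most general unifier of two types (standard Robinson unification). -}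

module Defs where

open import Data.Nat using (ℕ; zero; suc; _+_; _≟_; _≥_)
open import Data.Maybe using (Maybe; just; nothing) renaming (map to mapMaybe)
open import Data.Product using (Σ; _×_; ∃)
open import Data.Sum using (_⊎_)
open import Relation.Nullary using (¬_; yes; no)
open import Relation.Binary.PropositionalEquality using (_≡_)

-- Terms (de Bruijn indices; free variable x is index x at top level).
-- Constants are indexed by ℕ.

data Term : Set where
  var : ℕ → Term
  con : ℕ → Term
  app : Term → Term → Term
  lam : Term → Term

occ : ℕ → Term → ℕ
occ k (var x) with x ≟ k
... | yes _ = 1
... | no  _ = 0
occ k (con c)   = 0
occ k (app M N) = occ k M + occ k N
occ k (lam M)   = occ (suc k) M

data Linear : Term → Set where
  var : ∀ x → Linear (var x)
  con : ∀ c → Linear (con c)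
  app : ∀ {M N} → Linear M → Linear N → Linear (app M N)
  lam : ∀ {M} → occ 0 M ≡ 1 → Linear M → Linear (lam M)

ext : (ℕ → ℕ) → ℕ → ℕ
ext ρ zero    = zero
ext ρ (suc x) = suc (ρ x)

rename : (ℕ → ℕ) → Term → Term
rename ρ (var x)   = var (ρ x)
rename ρ (con c)   = con c
rename ρ (app M N) = app (rename ρ M) (rename ρ N)
rename ρ (lam M)   = lam (rename (ext ρ) M)

exts : (ℕ → Term) → ℕ → Term
exts σ zero    = var zero
exts σ (suc x) = rename suc (σ x)

subst : (ℕ → Term) → Term → Term
subst σ (var x)   = σ x
subst σ (con c)   = con c
subst σ (app M N) = app (subst σ M) (subst σ N)
subst σ (lam M)   = lam (subst (exts σ) M)

subst0 : Term → ℕ → Term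
subst0 N zero    = N
subst0 N (suc x) = var x

_[_] : Term → Term → Term
M [ N ] = subst (subst0 N) M

data _=βL_ : Term → Term → Set where
  beta  : ∀ {M N} → Linear (lam M) → Linear N → app (lam M) N =βL (M [ N ])
  xi    : ∀ {M N} → occ 0 M ≡ 1 → occ 0 N ≡ 1 → M =βL N → lam M =βL lam N
  appC  : ∀ {M M' N N'} → M =βL M' → N =βL N' → app M N =βL app M' N'
  refl  : ∀ {M} → M =βL M
  sym   : ∀ {M N} → M =βL N → N =βL M
  trans : ∀ {M N P} → M =βL N → N =βL P → M =βL P

infixr 7 _⇒_
data Ty : Set where
  tvar : ℕ → Ty
  _⇒_  : Ty → Ty → Ty

data _occursIn_ (a : ℕ) : Ty → Set where
  here  : a occursIn tvar a
  left  : ∀ {s t} → a occursIn s → a occursIn (s ⇒ t)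
  right : ∀ {s t} → a occursIn t → a occursIn (s ⇒ t)

TySubst : Set
TySubst = ℕ → Ty

applyT : TySubst → Ty → Ty
applyT U (tvar a) = U a
applyT U (s ⇒ t)  = applyT U s ⇒ applyT U t

_∘ₛ_ : TySubst → TySubst → TySubst
(U ∘ₛ V) a = applyT U (V a)

Unifies : TySubst → Ty → Ty → Set
Unifies U s t = applyT U s ≡ applyT U t

-- U is a most general unifier of s and t, with the properties of the
-- unifier computed by Robinson's algorithm: idempotent, identity outside
-- the variables of s,t, and introducing no new variables.
record IsMGU (U : TySubst) (s t : Ty) : Set where
  field
    unifies    : Unifies U s t
    general    : ∀ V → Unifies V s t → Σ TySubst λ W → ∀ a → V a ≡ applyT W (U a)
    idempotent : ∀ a → applyT U (U a) ≡ U a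
    support    : ∀ a → ¬ (a occursIn s) → ¬ (a occursIn t) → U a ≡ tvar a
    noNewVars  : ∀ a b → b occursIn U a → (a occursIn s ⊎ a occursIn t) →
                 b occursIn s ⊎ b occursIn t

Env : Set
Env = ℕ → Maybe Ty

singleton : ℕ → Ty → Env
singleton x t y with y ≟ x
... | yes _ = just t
... | no  _ = nothing

_∈TV_ : ℕ → Env → Set
a ∈TV Γ = Σ ℕ λ x → Σ Ty λ t → (Γ x ≡ just t) × (a occursIn t)

_∈TV⟨_,_⟩ : ℕ → Env → Ty → Set
a ∈TV⟨ Γ , μ ⟩ = a ∈TV Γ ⊎ a occursIn μ

DisjointDom : Env → Env → Set
DisjointDom Γ Δ = ∀ x → Γ x ≡ nothing ⊎ Δ x ≡ nothing

orElse : Maybe Ty → Maybe Ty → Maybe Ty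
orElse (just t) m = just t
orElse nothing  m = m

union : Env → Env → Env
union Γ Δ x = orElse (Γ x) (Δ x)

applyEnv : TySubst → Env → Env
applyEnv U Γ x = mapMaybe (applyT U) (Γ x)

-- Principal type schemes  Γ ⊩L M ∶ σ
-- (conclusion environments/types given up to pointwise equality)

data _⊩L_∶_ : Env → Term → Ty → Set where
  var : ∀ {Θ σ} x a →
        (∀ y → Θ y ≡ singleton x (tvar a) y) → σ ≡ tvar a →
        Θ ⊩L var x ∶ σ
  lam : ∀ {Θ Γ' M μ ν σ} →
        occ 0 M ≥ 1 →
        Γ' ⊩L M ∶ ν →
        Γ' 0 ≡ just μ →
        (∀ y → Θ y ≡ Γ' (suc y)) →
        σ ≡ μ ⇒ ν →
        Θ ⊩L lam M ∶ σ
  app : ∀ {Θ Γ Δ M N μ τ σ} (α β : ℕ) (U' U : TySubst) →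
        Γ ⊩L M ∶ μ →
        Δ ⊩L N ∶ τ →
        DisjointDom Γ Δ →
        (∀ a → a ∈TV⟨ Γ , μ ⟩ → ¬ (a ∈TV⟨ Δ , τ ⟩)) →
        ¬ (α ≡ β) →
        ¬ (α ∈TV⟨ Γ , μ ⟩) → ¬ (α ∈TV⟨ Δ , τ ⟩) →
        ¬ (β ∈TV⟨ Γ , μ ⟩) → ¬ (β ∈TV⟨ Δ , τ ⟩) →
        IsMGU U' μ (tvar α ⇒ tvar β) →
        IsMGU U (U' α) τ →
        (∀ y → Θ y ≡ applyEnv (U ∘ₛ U') (union Γ Δ) y) →
        σ ≡ applyT (U ∘ₛ U') (tvar β) →
        Θ ⊩L app M N ∶ σ

renameT : (ℕ → ℕ) → Ty → Ty
renameT ρ = applyT (λ a → tvar (ρ a))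

-- Forgetting its side conditions, ⊩L is a simple type system ⊢ for strictly linear
-- terms in which the environment is exactly the set of free variables. For such terms
-- ⊢ is invariant under =βL in both directions: β-reduction by the substitution lemma,
-- β-expansion by its converse, which needs the bound variable to occur exactly once.
-- Moreover ⊩L-typings are principal (every ⊢-typing of the term is an instance) and
-- exist for every ⊢-typable term, by Robinson unification. Hence Γ ⊢ M' ∶ σ, M' has a
-- principal typing Γ' ⊩L M' ∶ σ', and (Γ , σ) and (Γ' , σ') are instances of each other,
-- i.e. they differ by a permutation of type variables.
module Submission where

open import Defs
open import Data.Empty using (⊥-elim)
open import Data.List using (List; []; _∷_; _++_; length; filter)
open import Data.List.Membership.Propositional using (_∈_; _∉_)
open import Data.List.Membership.Propositional.Properties
  using (∈-++⁺ˡ; ∈-++⁺ʳ; ∈-++⁻; ∈-filter⁺; ∈-filter⁻)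
open import Data.List.Properties using (filter-notAll)
open import Data.List.Relation.Unary.All as All using (All; []; _∷_)
open import Data.List.Relation.Unary.Any as Any using (Any; here; there)
open import Data.Maybe using (just; nothing; maybe′) renaming (map to mapMaybe)
open import Data.Maybe.Properties using (just-injective)
  renaming (map-∘ to mapMaybe-∘; map-cong to mapMaybe-cong)
open import Data.Nat using (ℕ; zero; suc; _+_; _⊔_; _≤_; _<_; s≤s; _<?_) renaming (_≟_ to _≟ℕ_)
open import Data.Nat.Properties
  using ( ≤-refl; ≤-trans; ≤-reflexive; <-trans; <-≤-trans; n≤1+n; n<1+n; n≮n; <⇒≢; ≮⇒≥
        ; m≤n⇒m≤1+n; m≤n⇒m<n∨m≡n; m≤m+n; m≤n+m; m≤m⊔n; m≤n⊔m; suc-injective; m+n≡0⇒m≡0; m+n≡0⇒n≡0)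
open import Data.Nat.Tactic.RingSolver using (solve-∀)
open import Data.List.Membership.DecPropositional _≟ℕ_ using (_∈?_)
open import Data.Product using (Σ; _×_; _,_; proj₁; proj₂; ∃; uncurry)
open import Data.Sum using (_⊎_; inj₁; inj₂; [_,_]′)
open import Function using (_∘_; _⇔_; mk⇔; _↔_; mk↔ₛ′)
open import Function.Bundles using (module Equivalence; module Inverse)
import Function.Properties.Equivalence as ⇔
open import Function.Properties.Inverse using (↔-refl; ↔-trans)
open import Relation.Nullary using (¬_; Dec; yes; no)
open import Relation.Nullary.Decidable using (¬?) renaming (map to mapDec)
open import Relation.Binary.PropositionalEquality as ≡ using (_≡_; _≢_; _≗_; refl; cong; cong₂)

⇒-injectiveˡ : ∀ {s t s' t'} → s ⇒ t ≡ s' ⇒ t' → s ≡ s'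
⇒-injectiveˡ refl = refl

⇒-injectiveʳ : ∀ {s t s' t'} → s ⇒ t ≡ s' ⇒ t' → t ≡ t'
⇒-injectiveʳ refl = refl

tvar-injective : ∀ {a b} → tvar a ≡ tvar b → a ≡ b
tvar-injective refl = refl

_occursIn?_ : ∀ a t → Dec (a occursIn t)
a occursIn? tvar b with a ≟ℕ b
... | yes refl = yes here
... | no a≢b   = no λ { here → a≢b refl }
a occursIn? (s ⇒ t) with a occursIn? s | a occursIn? t
... | yes p | _     = yes (left p)
... | no _  | yes q = yes (right q)
... | no ¬p | no ¬q = no λ { (left p) → ¬p p ; (right q) → ¬q q }

applyT-cong : ∀ {U V} t → (∀ a → a occursIn t → U a ≡ V a) → applyT U t ≡ applyT V t
applyT-cong (tvar a) U≗V = U≗V a here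
applyT-cong (s ⇒ t)  U≗V =
  cong₂ _⇒_ (applyT-cong s λ a → U≗V a ∘ left) (applyT-cong t λ a → U≗V a ∘ right)

applyT-identity : ∀ {U} t → (∀ a → a occursIn t → U a ≡ tvar a) → applyT U t ≡ t
applyT-identity (tvar a) U≗id = U≗id a here
applyT-identity (s ⇒ t)  U≗id =
  cong₂ _⇒_ (applyT-identity s λ a o → U≗id a (left o)) (applyT-identity t λ a o → U≗id a (right o))

applyT-∘ : ∀ U V t → applyT (U ∘ₛ V) t ≡ applyT U (applyT V t)
applyT-∘ U V (tvar a) = refl
applyT-∘ U V (s ⇒ t)  = cong₂ _⇒_ (applyT-∘ U V s) (applyT-∘ U V t)

applyT-factor : ∀ {V W U} → (∀ a → V a ≡ applyT W (U a)) → ∀ t → applyT V t ≡ applyT W (applyT U t)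
applyT-factor {V} {W} {U} V≗WU t =
  ≡.trans (applyT-cong t λ a _ → V≗WU a) (applyT-∘ W U t)

applyT-idempotent : ∀ {U} → (∀ a → applyT U (U a) ≡ U a) → ∀ t → applyT U (applyT U t) ≡ applyT U t
applyT-idempotent {U} idem t = ≡.sym (applyT-factor (λ a → ≡.sym (idem a)) t)

occursIn-applyT⁻ : ∀ {U c} t → c occursIn applyT U t → ∃ λ d → d occursIn t × c occursIn U d
occursIn-applyT⁻ (tvar a) o = a , here , o
occursIn-applyT⁻ (s ⇒ t) (left o)  with d , d∈s , c∈Ud ← occursIn-applyT⁻ s o = d , left d∈s , c∈Ud
occursIn-applyT⁻ (s ⇒ t) (right o) with d , d∈t , c∈Ud ← occursIn-applyT⁻ t o = d , right d∈t , c∈Ud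

applyT-fixed⇒identity : ∀ {U a} t → applyT U t ≡ t → a occursIn t → U a ≡ tvar a
applyT-fixed⇒identity (tvar a) eq here      = eq
applyT-fixed⇒identity (s ⇒ t)  eq (left o)  = applyT-fixed⇒identity s (⇒-injectiveˡ eq) o
applyT-fixed⇒identity (s ⇒ t)  eq (right o) = applyT-fixed⇒identity t (⇒-injectiveʳ eq) o

size : Ty → ℕ
size (tvar _) = 1
size (s ⇒ t)  = suc (size s + size t)

size-applyT-occurs : ∀ V {a} t → a occursIn t → size (V a) ≤ size (applyT V t)
size-applyT-occurs V (tvar a) here     = ≤-refl
size-applyT-occurs V (s ⇒ t) (left o)  = m≤n⇒m≤1+n (≤-trans (size-applyT-occurs V s o) (m≤m+n _ _))
size-applyT-occurs V (s ⇒ t) (right o) = m≤n⇒m≤1+n (≤-trans (size-applyT-occurs V t o) (m≤n+m _ _))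

occurs-check : ∀ V {a} s t → a occursIn (s ⇒ t) → V a ≢ applyT V (s ⇒ t)
occurs-check V s t o eq = n≮n _ (≤-trans (s≤s (bound o)) (≤-reflexive (cong size (≡.sym eq))))
  where
  bound : ∀ {a} → a occursIn (s ⇒ t) → size (V a) ≤ size (applyT V s) + size (applyT V t)
  bound (left o)  = ≤-trans (size-applyT-occurs V s o) (m≤m+n _ _)
  bound (right o) = ≤-trans (size-applyT-occurs V t o) (m≤n+m _ _)

tyVars : Ty → List ℕ
tyVars (tvar a) = a ∷ []
tyVars (s ⇒ t)  = tyVars s ++ tyVars t

∈-tyVars⁺ : ∀ {a} t → a occursIn t → a ∈ tyVars t
∈-tyVars⁺ (tvar a) here      = here refl
∈-tyVars⁺ (s ⇒ t)  (left o)  = ∈-++⁺ˡ (∈-tyVars⁺ s o)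
∈-tyVars⁺ (s ⇒ t)  (right o) = ∈-++⁺ʳ (tyVars s) (∈-tyVars⁺ t o)

∈-tyVars⁻ : ∀ {a} t → a ∈ tyVars t → a occursIn t
∈-tyVars⁻ (tvar a) (here refl) = here
∈-tyVars⁻ (s ⇒ t) a∈ with ∈-++⁻ (tyVars s) a∈
... | inj₁ a∈s = left (∈-tyVars⁻ s a∈s)
... | inj₂ a∈t = right (∈-tyVars⁻ t a∈t)

-- Unification

Equation : Set
Equation = Ty × Ty

UnifiesAll : TySubst → List Equation → Set
UnifiesAll V = All (uncurry (Unifies V))

_occursInEq_ : ℕ → Equation → Set
a occursInEq (s , t) = a occursIn s ⊎ a occursIn t

_occursInEqs_ : ℕ → List Equation → Set
a occursInEqs E = Any (a occursInEq_) E

VarsWithin : List Equation → List ℕ → Set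
VarsWithin E X = ∀ b → b occursInEqs E → b ∈ X

applyEqs : TySubst → List Equation → List Equation
applyEqs σ []            = []
applyEqs σ ((s , t) ∷ E) = (applyT σ s , applyT σ t) ∷ applyEqs σ E

sizeEqs : List Equation → ℕ
sizeEqs []            = 0
sizeEqs ((s , t) ∷ E) = size s + size t + sizeEqs E

-- The properties of IsMGU, for a system of equations whose variables lie in X.
record IsMGUWithin (U : TySubst) (E : List Equation) (X : List ℕ) : Set where
  field
    unifies    : UnifiesAll U E
    general    : ∀ V → UnifiesAll V E → ∃ λ W → ∀ a → V a ≡ applyT W (U a)
    idempotent : ∀ a → applyT U (U a) ≡ U a
    support    : ∀ a → a ∉ X → U a ≡ tvar a
    noNewVars  : ∀ a b → b occursIn U a → a ∈ X → b ∈ X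

unifiesAll-applyEqs⁻ : ∀ {V σ} E → UnifiesAll V (applyEqs σ E) → UnifiesAll (V ∘ₛ σ) E
unifiesAll-applyEqs⁻ []            []       = []
unifiesAll-applyEqs⁻ {V} {σ} ((s , t) ∷ E) (e ∷ es) =
  ≡.trans (applyT-∘ V σ s) (≡.trans e (≡.sym (applyT-∘ V σ t))) ∷ unifiesAll-applyEqs⁻ E es

unifiesAll-absorb : ∀ {V σ} → (∀ b → V b ≡ applyT V (σ b)) →
                    ∀ E → UnifiesAll V E → UnifiesAll V (applyEqs σ E)
unifiesAll-absorb absorb []            []       = []
unifiesAll-absorb absorb ((s , t) ∷ E) (e ∷ es) =
  ≡.trans (≡.sym (applyT-factor absorb s)) (≡.trans e (applyT-factor absorb t))
    ∷ unifiesAll-absorb absorb E es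

occursInEqs-applyEqs⁻ : ∀ {σ c} E → c occursInEqs applyEqs σ E →
                        ∃ λ d → d occursInEqs E × c occursIn σ d
occursInEqs-applyEqs⁻ ((s , t) ∷ E) (here (inj₁ o)) with d , d∈s , c∈σd ← occursIn-applyT⁻ s o =
  d , here (inj₁ d∈s) , c∈σd
occursInEqs-applyEqs⁻ ((s , t) ∷ E) (here (inj₂ o)) with d , d∈t , c∈σd ← occursIn-applyT⁻ t o =
  d , here (inj₂ d∈t) , c∈σd
occursInEqs-applyEqs⁻ ((s , t) ∷ E) (there o) with d , d∈E , c∈σd ← occursInEqs-applyEqs⁻ E o =
  d , there d∈E , c∈σd

_↦_ : ℕ → Ty → TySubst
(a ↦ t) b with b ≟ℕ a
... | yes _ = t
... | no _  = tvar b

↦-self : ∀ a t → (a ↦ t) a ≡ t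
↦-self a t with a ≟ℕ a
... | yes _  = refl
... | no a≢a = ⊥-elim (a≢a refl)

↦-other : ∀ {a b} t → b ≢ a → (a ↦ t) b ≡ tvar b
↦-other {a} {b} t b≢a with b ≟ℕ a
... | yes b≡a = ⊥-elim (b≢a b≡a)
... | no _    = refl

↦-occurs⁻ : ∀ {a t b d} → d occursIn (a ↦ t) b → (b ≡ a × d occursIn t) ⊎ d ≡ b
↦-occurs⁻ {a} {t} {b} o with b ≟ℕ a
↦-occurs⁻ o    | yes b≡a = inj₁ (b≡a , o)
↦-occurs⁻ here | no _    = inj₂ refl

unifier-absorbs-↦ : ∀ {V a t} → V a ≡ applyT V t → ∀ b → V b ≡ applyT V ((a ↦ t) b)
unifier-absorbs-↦ {a = a} Va≡Vt b with b ≟ℕ a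
... | yes refl = Va≡Vt
... | no _     = refl

_∖_ : List ℕ → ℕ → List ℕ
X ∖ a = filter (λ b → ¬? (b ≟ℕ a)) X

∈-∖⁺ : ∀ {a b X} → b ∈ X → b ≢ a → b ∈ X ∖ a
∈-∖⁺ {a} = ∈-filter⁺ (λ b → ¬? (b ≟ℕ a))

∈-∖⁻ : ∀ {a b} X → b ∈ X ∖ a → b ∈ X × b ≢ a
∈-∖⁻ {a} X = ∈-filter⁻ (λ b → ¬? (b ≟ℕ a)) {xs = X}

length-∖ : ∀ {a X} → a ∈ X → length (X ∖ a) < length X
length-∖ {a} {X} a∈X = filter-notAll (λ b → ¬? (b ≟ℕ a)) X (Any.map (λ { refl b≢b → b≢b refl }) a∈X)

module _ {a t E X} (a∉t : ¬ a occursIn t) (vars : VarsWithin ((tvar a , t) ∷ E) X) where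

  ↦-eliminates : ∀ {b d} → d occursIn (a ↦ t) b → d ≢ a
  ↦-eliminates o refl with ↦-occurs⁻ {a} {t} o
  ... | inj₁ (_ , a∈t) = a∉t a∈t
  ... | inj₂ refl      = a∉t (≡.subst (a occursIn_) (↦-self a t) o)

  ↦-vars : ∀ {b d} → d occursIn (a ↦ t) b → b ∈ X → d ∈ X
  ↦-vars o b∈X with ↦-occurs⁻ {a} {t} o
  ... | inj₁ (_ , d∈t) = vars _ (here (inj₂ d∈t))
  ... | inj₂ refl      = b∈X

  a∈X : a ∈ X
  a∈X = vars a (here (inj₁ here))

  vars-applyEqs : VarsWithin (applyEqs (a ↦ t) E) (X ∖ a)
  vars-applyEqs c o with d , d∈E , c∈σd ← occursInEqs-applyEqs⁻ E o =
    ∈-∖⁺ (↦-vars c∈σd (vars d (there d∈E))) (↦-eliminates c∈σd)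

  module _ {θ} (R : IsMGUWithin θ (applyEqs (a ↦ t) E) (X ∖ a)) where
    private module R = IsMGUWithin R

    θ-avoids : ∀ {d} → d ≢ a → ¬ a occursIn θ d
    θ-avoids {d} d≢a o with d ∈? (X ∖ a)
    ... | yes d∈X∖a = proj₂ (∈-∖⁻ X (R.noNewVars d a o d∈X∖a)) refl
    ... | no d∉X∖a  with here ← ≡.subst (a occursIn_) (R.support d d∉X∖a) o = d≢a refl

    isMGUWithin-bind : IsMGUWithin (θ ∘ₛ (a ↦ t)) ((tvar a , t) ∷ E) X
    isMGUWithin-bind = record
      { unifies    = unifies-head ∷ unifiesAll-applyEqs⁻ E R.unifies
      ; general    = general
      ; idempotent = idempotent
      ; support    = support
      ; noNewVars  = noNewVars
      }
      where
      σt≡t : applyT (a ↦ t) t ≡ t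
      σt≡t = applyT-identity t λ b b∈t → ↦-other t λ { refl → a∉t b∈t }

      unifies-head : applyT θ ((a ↦ t) a) ≡ applyT (θ ∘ₛ (a ↦ t)) t
      unifies-head = begin
        applyT θ ((a ↦ t) a)         ≡⟨ cong (applyT θ) (↦-self a t) ⟩
        applyT θ t                   ≡⟨ cong (applyT θ) σt≡t ⟨
        applyT θ (applyT (a ↦ t) t)  ≡⟨ applyT-∘ θ (a ↦ t) t ⟨
        applyT (θ ∘ₛ (a ↦ t)) t      ∎
        where open ≡.≡-Reasoning

      general : ∀ V → UnifiesAll V ((tvar a , t) ∷ E) →
                ∃ λ W → ∀ b → V b ≡ applyT W (applyT θ ((a ↦ t) b))
      general V (Va≡Vt ∷ VE) = factor (R.general V (unifiesAll-absorb absorb E VE))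
        where
        absorb : ∀ b → V b ≡ applyT V ((a ↦ t) b)
        absorb = unifier-absorbs-↦ Va≡Vt
        factor : (∃ λ W → ∀ b → V b ≡ applyT W (θ b)) →
                 ∃ λ W → ∀ b → V b ≡ applyT W (applyT θ ((a ↦ t) b))
        factor (W , V≗Wθ) = W , λ b → ≡.trans (absorb b) (applyT-factor V≗Wθ ((a ↦ t) b))

      -- θ maps every variable other than a to a type without a, and a ↦ t removes a.
      idempotent : ∀ b → applyT (θ ∘ₛ (a ↦ t)) (applyT θ ((a ↦ t) b)) ≡ applyT θ ((a ↦ t) b)
      idempotent b = begin
        applyT (θ ∘ₛ (a ↦ t)) u    ≡⟨ applyT-∘ θ (a ↦ t) u ⟩
        applyT θ (applyT (a ↦ t) u) ≡⟨ cong (applyT θ) (applyT-identity u σ-fixes) ⟩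
        applyT θ u                  ≡⟨ applyT-idempotent R.idempotent ((a ↦ t) b) ⟩
        u                           ∎
        where
        open ≡.≡-Reasoning
        u : Ty
        u = applyT θ ((a ↦ t) b)
        σ-fixes : ∀ c → c occursIn u → (a ↦ t) c ≡ tvar c
        σ-fixes c o with d , d∈σb , c∈θd ← occursIn-applyT⁻ ((a ↦ t) b) o =
          ↦-other t λ { refl → θ-avoids (↦-eliminates d∈σb) c∈θd }

      support : ∀ b → b ∉ X → applyT θ ((a ↦ t) b) ≡ tvar b
      support b b∉X with b ≟ℕ a
      ... | yes refl = ⊥-elim (b∉X a∈X)
      ... | no _     = R.support b λ b∈X∖a → b∉X (proj₁ (∈-∖⁻ X b∈X∖a))

      noNewVars : ∀ b c → c occursIn applyT θ ((a ↦ t) b) → b ∈ X → c ∈ X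
      noNewVars b c o b∈X with d , d∈σb , c∈θd ← occursIn-applyT⁻ ((a ↦ t) b) o =
        proj₁ (∈-∖⁻ X (R.noNewVars d c c∈θd (∈-∖⁺ (↦-vars d∈σb b∈X) (↦-eliminates d∈σb))))

isMGUWithin-[] : ∀ X → IsMGUWithin tvar [] X
isMGUWithin-[] X = record
  { unifies    = []
  ; general    = λ V _ → V , λ _ → refl
  ; idempotent = λ _ → refl
  ; support    = λ _ _ → refl
  ; noNewVars  = λ { a .a here a∈X → a∈X }
  }

isMGUWithin-trivial : ∀ {U a E X} → IsMGUWithin U E X → IsMGUWithin U ((tvar a , tvar a) ∷ E) X
isMGUWithin-trivial R = record
  { unifies = refl ∷ R.unifies ; general = λ { V (_ ∷ VE) → R.general V VE }
  ; idempotent = R.idempotent ; support = R.support ; noNewVars = R.noNewVars }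
  where module R = IsMGUWithin R

isMGUWithin-flip : ∀ {U s t E X} → IsMGUWithin U ((s , t) ∷ E) X → IsMGUWithin U ((t , s) ∷ E) X
isMGUWithin-flip R = record
  { unifies = flip R.unifies ; general = λ V VE → R.general V (flip VE)
  ; idempotent = R.idempotent ; support = R.support ; noNewVars = R.noNewVars }
  where
  module R = IsMGUWithin R
  flip : ∀ {U s t E} → UnifiesAll U ((s , t) ∷ E) → UnifiesAll U ((t , s) ∷ E)
  flip (e ∷ UE) = ≡.sym e ∷ UE

isMGUWithin-decompose : ∀ {U s₁ s₂ t₁ t₂ E X} →
  IsMGUWithin U ((s₁ , t₁) ∷ (s₂ , t₂) ∷ E) X → IsMGUWithin U ((s₁ ⇒ s₂ , t₁ ⇒ t₂) ∷ E) X
isMGUWithin-decompose R = record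
  { unifies = compose R.unifies ; general = λ V VE → R.general V (decompose VE)
  ; idempotent = R.idempotent ; support = R.support ; noNewVars = R.noNewVars }
  where
  module R = IsMGUWithin R
  compose : ∀ {U s₁ s₂ t₁ t₂ E} → UnifiesAll U ((s₁ , t₁) ∷ (s₂ , t₂) ∷ E) →
            UnifiesAll U ((s₁ ⇒ s₂ , t₁ ⇒ t₂) ∷ E)
  compose (e₁ ∷ e₂ ∷ UE) = cong₂ _⇒_ e₁ e₂ ∷ UE
  decompose : ∀ {U s₁ s₂ t₁ t₂ E} → UnifiesAll U ((s₁ ⇒ s₂ , t₁ ⇒ t₂) ∷ E) →
              UnifiesAll U ((s₁ , t₁) ∷ (s₂ , t₂) ∷ E)
  decompose (e ∷ UE) = ⇒-injectiveˡ e ∷ ⇒-injectiveʳ e ∷ UE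

varsWithin-flip : ∀ {s t E X} → VarsWithin ((s , t) ∷ E) X → VarsWithin ((t , s) ∷ E) X
varsWithin-flip vars b (here (inj₁ o)) = vars b (here (inj₂ o))
varsWithin-flip vars b (here (inj₂ o)) = vars b (here (inj₁ o))
varsWithin-flip vars b (there o)       = vars b (there o)

varsWithin-decompose : ∀ {s₁ s₂ t₁ t₂ E X} →
  VarsWithin ((s₁ ⇒ s₂ , t₁ ⇒ t₂) ∷ E) X → VarsWithin ((s₁ , t₁) ∷ (s₂ , t₂) ∷ E) X
varsWithin-decompose vars b (here (inj₁ o))         = vars b (here (inj₁ (left o)))
varsWithin-decompose vars b (here (inj₂ o))         = vars b (here (inj₂ (left o)))
varsWithin-decompose vars b (there (here (inj₁ o))) = vars b (here (inj₁ (right o)))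
varsWithin-decompose vars b (there (here (inj₂ o))) = vars b (here (inj₂ (right o)))
varsWithin-decompose vars b (there (there o))       = vars b (there o)

sizeEqs-decompose : ∀ s₁ s₂ t₁ t₂ E →
  sizeEqs ((s₁ , t₁) ∷ (s₂ , t₂) ∷ E) < sizeEqs ((s₁ ⇒ s₂ , t₁ ⇒ t₂) ∷ E)
sizeEqs-decompose s₁ s₂ t₁ t₂ E =
  ≤-trans (n≤1+n _) (≤-reflexive (rearrange (size s₁) (size s₂) (size t₁) (size t₂) (sizeEqs E)))
  where
  rearrange : ∀ a b c d e → suc (suc (a + c + (b + d + e))) ≡ suc (a + b) + suc (c + d) + e
  rearrange = solve-∀

private
  shrink : ∀ {k l m} → k < l → l < suc m → k < m
  shrink k<l (s≤s l≤m) = <-≤-trans k<l l≤m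

-- Robinson's algorithm; each variable elimination shrinks the variable set,
-- every other step shrinks the system.
mutual
  mguWithin : ∀ n m E X → length X < n → sizeEqs E < m → VarsWithin E X →
              ∀ V → UnifiesAll V E → ∃ λ U → IsMGUWithin U E X
  mguWithin n m       []                    X _     _  _    V _ = tvar , isMGUWithin-[] X
  mguWithin n (suc m) ((tvar a , tvar b) ∷ E) X |X|<n sz vars V (e ∷ VE) with a ≟ℕ b
  ... | yes refl = let U , R = mguWithin n m E X |X|<n (shrink (n≤1+n _) sz) (λ c → vars c ∘ there) V VE
                   in U , isMGUWithin-trivial R
  ... | no a≢b   = mguWithin-bind n |X|<n (λ { here → a≢b refl }) vars V (e ∷ VE)
  mguWithin n (suc m) ((tvar a , s ⇒ t) ∷ E) X |X|<n sz vars V (e ∷ VE) with a occursIn? (s ⇒ t)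
  ... | yes a∈s⇒t = ⊥-elim (occurs-check V s t a∈s⇒t e)
  ... | no a∉s⇒t  = mguWithin-bind n |X|<n a∉s⇒t vars V (e ∷ VE)
  mguWithin n (suc m) ((s ⇒ t , tvar a) ∷ E) X |X|<n sz vars V (e ∷ VE) with a occursIn? (s ⇒ t)
  ... | yes a∈s⇒t = ⊥-elim (occurs-check V s t a∈s⇒t (≡.sym e))
  ... | no a∉s⇒t  = let U , R = mguWithin-bind n |X|<n a∉s⇒t (varsWithin-flip vars) V (≡.sym e ∷ VE)
                    in U , isMGUWithin-flip R
  mguWithin n (suc m) ((s₁ ⇒ s₂ , t₁ ⇒ t₂) ∷ E) X |X|<n sz vars V (e ∷ VE) =
    let U , R = mguWithin n m ((s₁ , t₁) ∷ (s₂ , t₂) ∷ E) X |X|<n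
                  (shrink (sizeEqs-decompose s₁ s₂ t₁ t₂ E) sz) (varsWithin-decompose vars)
                  V (⇒-injectiveˡ e ∷ ⇒-injectiveʳ e ∷ VE)
    in U , isMGUWithin-decompose R

  mguWithin-bind : ∀ n {a t E X} → length X < n → ¬ a occursIn t → VarsWithin ((tvar a , t) ∷ E) X →
                   ∀ V → UnifiesAll V ((tvar a , t) ∷ E) → ∃ λ U → IsMGUWithin U ((tvar a , t) ∷ E) X
  mguWithin-bind (suc n) {a} {t} {E} {X} |X|<n a∉t vars V (e ∷ VE) =
    let θ , R = mguWithin n (suc (sizeEqs (applyEqs (a ↦ t) E))) (applyEqs (a ↦ t) E) (X ∖ a)
                  (shrink (length-∖ (a∈X a∉t vars)) |X|<n) ≤-refl (vars-applyEqs a∉t vars)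
                  V (unifiesAll-absorb (unifier-absorbs-↦ e) E VE)
    in θ ∘ₛ (a ↦ t) , isMGUWithin-bind a∉t vars R

mgu : ∀ s t V → Unifies V s t → ∃ λ U → IsMGU U s t
mgu s t V e =
  let U , R = mguWithin (suc (length X)) (suc (sizeEqs E)) E X ≤-refl ≤-refl vars V (e ∷ [])
      module R = IsMGUWithin R
  in U , record
    { unifies    = All.head R.unifies
    ; general    = λ V' e' → R.general V' (e' ∷ [])
    ; idempotent = R.idempotent
    ; support    = λ a a∉s a∉t → R.support a λ a∈X → [ a∉s , a∉t ]′ (occurs a∈X)
    ; noNewVars  = λ a b o a∈st → occurs (R.noNewVars a b o (vars a (here a∈st)))
    }
  where
  E : List Equation
  E = (s , t) ∷ []
  X : List ℕ
  X = tyVars s ++ tyVars t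
  vars : VarsWithin E X
  vars b (here (inj₁ o)) = ∈-++⁺ˡ (∈-tyVars⁺ s o)
  vars b (here (inj₂ o)) = ∈-++⁺ʳ (tyVars s) (∈-tyVars⁺ t o)
  occurs : ∀ {b} → b ∈ X → b occursIn s ⊎ b occursIn t
  occurs b∈X with ∈-++⁻ (tyVars s) b∈X
  ... | inj₁ b∈s = inj₁ (∈-tyVars⁻ s b∈s)
  ... | inj₂ b∈t = inj₂ (∈-tyVars⁻ t b∈t)

orElse-assoc : ∀ a b c → orElse (orElse a b) c ≡ orElse a (orElse b c)
orElse-assoc (just _) b c = refl
orElse-assoc nothing  b c = refl

orElse-comm : ∀ a b → a ≡ nothing ⊎ b ≡ nothing → orElse a b ≡ orElse b a
orElse-comm (just _) nothing  _ = refl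
orElse-comm nothing  (just _) _ = refl
orElse-comm nothing  nothing  _ = refl
orElse-comm (just _) (just _) (inj₁ ())
orElse-comm (just _) (just _) (inj₂ ())

orElse-nothingʳ : ∀ a → orElse a nothing ≡ a
orElse-nothingʳ (just _) = refl
orElse-nothingʳ nothing  = refl

orElse-nothing⁻ : ∀ a b → orElse a b ≡ nothing → a ≡ nothing × b ≡ nothing
orElse-nothing⁻ nothing b eq = refl , eq

orElse-just⁻ : ∀ a b {t} → orElse a b ≡ just t → a ≡ just t ⊎ (a ≡ nothing × b ≡ just t)
orElse-just⁻ (just _) b eq = inj₁ eq
orElse-just⁻ nothing  b eq = inj₂ (refl , eq)

mapMaybe-orElse : ∀ (f : Ty → Ty) a b → mapMaybe f (orElse a b) ≡ orElse (mapMaybe f a) (mapMaybe f b)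
mapMaybe-orElse f (just _) b = refl
mapMaybe-orElse f nothing  b = refl

union-cong : ∀ {A A' B B'} → A ≗ A' → B ≗ B' → union A B ≗ union A' B'
union-cong A≗A' B≗B' x = cong₂ orElse (A≗A' x) (B≗B' x)

union-congˡ : ∀ {A A'} B → A ≗ A' → union A B ≗ union A' B
union-congˡ B A≗A' = union-cong A≗A' (λ _ → refl)

union-congʳ : ∀ A {B B'} → B ≗ B' → union A B ≗ union A B'
union-congʳ A B≗B' = union-cong (λ _ → refl) B≗B'

union-assoc : ∀ A B C → union (union A B) C ≗ union A (union B C)
union-assoc A B C x = orElse-assoc (A x) (B x) (C x)

union-comm : ∀ {A B} → DisjointDom A B → union A B ≗ union B A
union-comm {A} {B} A#B x = orElse-comm (A x) (B x) (A#B x)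

disjoint-sym : ∀ {A B} → DisjointDom A B → DisjointDom B A
disjoint-sym A#B x = [ inj₂ , inj₁ ]′ (A#B x)

disjoint-resp : ∀ {A A' B B'} → A ≗ A' → B ≗ B' → DisjointDom A B → DisjointDom A' B'
disjoint-resp A≗A' B≗B' A#B x with A#B x
... | inj₁ Ax≡∅ = inj₁ (≡.trans (≡.sym (A≗A' x)) Ax≡∅)
... | inj₂ Bx≡∅ = inj₂ (≡.trans (≡.sym (B≗B' x)) Bx≡∅)

disjoint-union⁺ : ∀ {A B C} → DisjointDom A C → DisjointDom B C → DisjointDom (union A B) C
disjoint-union⁺ {A} {B} A#C B#C x with A#C x | B#C x
... | inj₂ Cx≡∅ | _         = inj₂ Cx≡∅
... | _         | inj₂ Cx≡∅ = inj₂ Cx≡∅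
... | inj₁ Ax≡∅ | inj₁ Bx≡∅ = inj₁ (cong₂ orElse Ax≡∅ Bx≡∅)

disjoint-unionˡ⁻ : ∀ {A B C} → DisjointDom (union A B) C → DisjointDom A C
disjoint-unionˡ⁻ {A} {B} AB#C x = [ inj₁ ∘ proj₁ ∘ orElse-nothing⁻ (A x) (B x) , inj₂ ]′ (AB#C x)

disjoint-unionʳ⁻ : ∀ {A B C} → DisjointDom (union A B) C → DisjointDom B C
disjoint-unionʳ⁻ {A} {B} AB#C x = [ inj₁ ∘ proj₂ ∘ orElse-nothing⁻ (A x) (B x) , inj₂ ]′ (AB#C x)

union-swapʳ : ∀ A {B C} → DisjointDom B C → union (union A B) C ≗ union (union A C) B
union-swapʳ A {B} {C} B#C x = begin
  union (union A B) C x ≡⟨ union-assoc A B C x ⟩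
  union A (union B C) x ≡⟨ cong (orElse (A x)) (union-comm B#C x) ⟩
  union A (union C B) x ≡⟨ union-assoc A C B x ⟨
  union (union A C) B x ∎
  where open ≡.≡-Reasoning

singleton-self : ∀ x t → singleton x t x ≡ just t
singleton-self x t with x ≟ℕ x
... | yes _  = refl
... | no x≢x = ⊥-elim (x≢x refl)

singleton-other : ∀ {x y} t → y ≢ x → singleton x t y ≡ nothing
singleton-other {x} {y} t y≢x with y ≟ℕ x
... | yes y≡x = ⊥-elim (y≢x y≡x)
... | no _    = refl

singleton-just⁻ : ∀ {x t y u} → singleton x t y ≡ just u → y ≡ x × t ≡ u
singleton-just⁻ {x} {y = y} eq with y ≟ℕ x
singleton-just⁻ refl | yes y≡x = y≡x , refl

singleton-cong : ∀ {x x' y y'} t → (y ≡ x → y' ≡ x') → (y' ≡ x' → y ≡ x) →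
                 singleton x t y ≡ singleton x' t y'
singleton-cong {x} {x'} {y} {y'} t to from with y ≟ℕ x | y' ≟ℕ x'
... | yes _    | yes _     = refl
... | no _     | no _      = refl
... | yes y≡x  | no y'≢x'  = ⊥-elim (y'≢x' (to y≡x))
... | no y≢x   | yes y'≡x' = ⊥-elim (y≢x (from y'≡x'))

mapMaybe-singleton : ∀ f x t y → mapMaybe f (singleton x t y) ≡ singleton x (f t) y
mapMaybe-singleton f x t y with y ≟ℕ x
... | yes _ = refl
... | no _  = refl

punchIn : ℕ → ℕ → ℕ
punchIn zero    x       = suc x
punchIn (suc k) zero    = zero
punchIn (suc k) (suc x) = suc (punchIn k x)

-- punchOut k k is a junk value.
punchOut : ℕ → ℕ → ℕ
punchOut zero    zero    = zero
punchOut zero    (suc x) = x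
punchOut (suc k) zero    = zero
punchOut (suc k) (suc x) = suc (punchOut k x)

punchInₖ≢k : ∀ k x → punchIn k x ≢ k
punchInₖ≢k (suc k) (suc x) eq = punchInₖ≢k k x (suc-injective eq)

punchOut-punchIn : ∀ k x → punchOut k (punchIn k x) ≡ x
punchOut-punchIn zero    x       = refl
punchOut-punchIn (suc k) zero    = refl
punchOut-punchIn (suc k) (suc x) = cong suc (punchOut-punchIn k x)

punchIn-punchOut : ∀ {k x} → x ≢ k → punchIn k (punchOut k x) ≡ x
punchIn-punchOut {zero}  {zero}  x≢k = ⊥-elim (x≢k refl)
punchIn-punchOut {zero}  {suc x} x≢k = refl
punchIn-punchOut {suc k} {zero}  x≢k = refl
punchIn-punchOut {suc k} {suc x} x≢k = cong suc (punchIn-punchOut (x≢k ∘ cong suc))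

strengthenEnv : ℕ → Env → Env
strengthenEnv k Γ = Γ ∘ punchIn k

weakenEnv : ℕ → Env → Env
weakenEnv zero    Γ zero    = nothing
weakenEnv zero    Γ (suc y) = Γ y
weakenEnv (suc k) Γ zero    = Γ zero
weakenEnv (suc k) Γ (suc y) = weakenEnv k (strengthenEnv 0 Γ) y

weakenEnv-self : ∀ k Γ → weakenEnv k Γ k ≡ nothing
weakenEnv-self zero    Γ = refl
weakenEnv-self (suc k) Γ = weakenEnv-self k (strengthenEnv 0 Γ)

weakenEnv-other : ∀ k Γ {y} → y ≢ k → weakenEnv k Γ y ≡ Γ (punchOut k y)
weakenEnv-other zero    Γ {zero}  y≢k = ⊥-elim (y≢k refl)
weakenEnv-other zero    Γ {suc y} y≢k = refl
weakenEnv-other (suc k) Γ {zero}  y≢k = refl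
weakenEnv-other (suc k) Γ {suc y} y≢k = weakenEnv-other k (strengthenEnv 0 Γ) (y≢k ∘ cong suc)

strengthenEnv-weakenEnv : ∀ k Γ → strengthenEnv k (weakenEnv k Γ) ≗ Γ
strengthenEnv-weakenEnv k Γ y =
  ≡.trans (weakenEnv-other k Γ (punchInₖ≢k k y)) (cong Γ (punchOut-punchIn k y))

weakenEnv-cong : ∀ k {Γ Γ'} → Γ ≗ Γ' → weakenEnv k Γ ≗ weakenEnv k Γ'
weakenEnv-cong k {Γ} {Γ'} Γ≗Γ' y with y ≟ℕ k
... | yes refl = ≡.trans (weakenEnv-self k Γ) (≡.sym (weakenEnv-self k Γ'))
... | no y≢k   = ≡.trans (weakenEnv-other k Γ y≢k) (≡.trans (Γ≗Γ' _) (≡.sym (weakenEnv-other k Γ' y≢k)))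

weakenEnv-union : ∀ k A B → weakenEnv k (union A B) ≗ union (weakenEnv k A) (weakenEnv k B)
weakenEnv-union k A B y with y ≟ℕ k
... | yes refl = ≡.trans (weakenEnv-self k _) (≡.sym (cong₂ orElse (weakenEnv-self k A) (weakenEnv-self k B)))
... | no y≢k   = ≡.trans (weakenEnv-other k _ y≢k)
                   (≡.sym (cong₂ orElse (weakenEnv-other k A y≢k) (weakenEnv-other k B y≢k)))

weakenEnv-disjoint : ∀ k {A B} → DisjointDom A B → DisjointDom (weakenEnv k A) (weakenEnv k B)
weakenEnv-disjoint k {A} {B} A#B y with y ≟ℕ k
... | yes refl = inj₁ (weakenEnv-self k A)
... | no y≢k with A#B (punchOut k y)
...   | inj₁ A≡∅ = inj₁ (≡.trans (weakenEnv-other k A y≢k) A≡∅)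
...   | inj₂ B≡∅ = inj₂ (≡.trans (weakenEnv-other k B y≢k) B≡∅)

disjoint-weakenEnv : ∀ k {A B} → DisjointDom (strengthenEnv k A) B → DisjointDom A (weakenEnv k B)
disjoint-weakenEnv k {A} {B} A#B y with y ≟ℕ k
... | yes refl = inj₂ (weakenEnv-self k B)
... | no y≢k with A#B (punchOut k y)
...   | inj₁ A≡∅ = inj₁ (≡.trans (cong A (≡.sym (punchIn-punchOut y≢k))) A≡∅)
...   | inj₂ B≡∅ = inj₂ (≡.trans (weakenEnv-other k B y≢k) B≡∅)

weakenEnv-singleton : ∀ k x t → weakenEnv k (singleton x t) ≗ singleton (punchIn k x) t
weakenEnv-singleton k x t y with y ≟ℕ k
... | yes refl = ≡.trans (weakenEnv-self k _) (≡.sym (singleton-other t (punchInₖ≢k k x ∘ ≡.sym)))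
... | no y≢k   = ≡.trans (weakenEnv-other k _ y≢k)
                   (singleton-cong t (λ { refl → ≡.sym (punchIn-punchOut y≢k) }) (λ { refl → punchOut-punchIn k x }))

strengthenEnv-singleton : ∀ {k x} t → x ≢ k → strengthenEnv k (singleton x t) ≗ singleton (punchOut k x) t
strengthenEnv-singleton {k} t x≢k y =
  singleton-cong t (λ { refl → ≡.sym (punchOut-punchIn k y) }) (λ { refl → punchIn-punchOut x≢k })

occ-var-self : ∀ x → 1 ≤ occ x (var x)
occ-var-self x with x ≟ℕ x
... | yes _  = ≤-refl
... | no x≢x = ⊥-elim (x≢x refl)

occ-var≡0⇒≢ : ∀ {k x} → occ k (var x) ≡ 0 → x ≢ k
occ-var≡0⇒≢ {k} {x} eq with x ≟ℕ k
occ-var≡0⇒≢ () | yes _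
... | no x≢k = x≢k

occ-var≡1⇒≡ : ∀ {k x} → occ k (var x) ≡ 1 → x ≡ k
occ-var≡1⇒≡ {k} {x} eq with x ≟ℕ k
... | yes x≡k = x≡k
occ-var≡1⇒≡ () | no _

m+n≡1-cases : ∀ m {n} → m + n ≡ 1 → (m ≡ 1 × n ≡ 0) ⊎ (m ≡ 0 × n ≡ 1)
m+n≡1-cases zero          eq   = inj₂ (refl , eq)
m+n≡1-cases (suc zero)    refl = inj₁ (refl , refl)

-- Simple typing of strictly linear terms, invariant under =βL

infix 4 _⊢_∶_
data _⊢_∶_ : Env → Term → Ty → Set where
  ⊢var : ∀ {Θ t} x → Θ ≗ singleton x t → Θ ⊢ var x ∶ t
  ⊢lam : ∀ {Θ Γ M μ ν} → Γ 0 ≡ just μ → Θ ≗ strengthenEnv 0 Γ → Γ ⊢ M ∶ ν → Θ ⊢ lam M ∶ μ ⇒ ν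
  ⊢app : ∀ {Θ Γ Δ M N μ ν} → DisjointDom Γ Δ → Θ ≗ union Γ Δ →
         Γ ⊢ M ∶ μ ⇒ ν → Δ ⊢ N ∶ μ → Θ ⊢ app M N ∶ ν

⊢-resp-≗ : ∀ {Θ Θ' M t} → Θ ≗ Θ' → Θ ⊢ M ∶ t → Θ' ⊢ M ∶ t
⊢-resp-≗ Θ≗Θ' (⊢var x Θ≗)         = ⊢var x λ y → ≡.trans (≡.sym (Θ≗Θ' y)) (Θ≗ y)
⊢-resp-≗ Θ≗Θ' (⊢lam Γ0 Θ≗ ⊢M)     = ⊢lam Γ0 (λ y → ≡.trans (≡.sym (Θ≗Θ' y)) (Θ≗ y)) ⊢M
⊢-resp-≗ Θ≗Θ' (⊢app Γ#Δ Θ≗ ⊢M ⊢N) = ⊢app Γ#Δ (λ y → ≡.trans (≡.sym (Θ≗Θ' y)) (Θ≗ y)) ⊢M ⊢N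

ext-punchIn : ∀ {ρ j} → ρ ≗ punchIn j → ext ρ ≗ punchIn (suc j)
ext-punchIn ρ≗ zero    = refl
ext-punchIn ρ≗ (suc x) = cong suc (ρ≗ x)

⊢-rename⁺ : ∀ {Θ N t ρ} j → ρ ≗ punchIn j → Θ ⊢ N ∶ t → weakenEnv j Θ ⊢ rename ρ N ∶ t
⊢-rename⁺ {t = t} j ρ≗ (⊢var x Θ≗) rewrite ρ≗ x =
  ⊢var (punchIn j x) λ y → ≡.trans (weakenEnv-cong j Θ≗ y) (weakenEnv-singleton j x t y)
⊢-rename⁺ j ρ≗ (⊢lam Γ0 Θ≗ ⊢M) =
  ⊢lam Γ0 (weakenEnv-cong j Θ≗) (⊢-rename⁺ (suc j) (ext-punchIn ρ≗) ⊢M)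
⊢-rename⁺ j ρ≗ (⊢app {Γ = Γ} {Δ = Δ} Γ#Δ Θ≗ ⊢M ⊢N) =
  ⊢app (weakenEnv-disjoint j Γ#Δ) (λ y → ≡.trans (weakenEnv-cong j Θ≗ y) (weakenEnv-union j Γ Δ y))
       (⊢-rename⁺ j ρ≗ ⊢M) (⊢-rename⁺ j ρ≗ ⊢N)

⊢-rename⁻ : ∀ {Θ t ρ} j N → ρ ≗ punchIn j → Θ ⊢ rename ρ N ∶ t →
            Θ j ≡ nothing × strengthenEnv j Θ ⊢ N ∶ t
⊢-rename⁻ {t = t} j (var x) ρ≗ (⊢var _ Θ≗) rewrite ρ≗ x =
  ≡.trans (Θ≗ j) (singleton-other t (punchInₖ≢k j x ∘ ≡.sym)) ,
  ⊢var x λ y → ≡.trans (Θ≗ (punchIn j y))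
    (≡.trans (strengthenEnv-singleton t (punchInₖ≢k j x) y)
             (cong (λ z → singleton z t y) (punchOut-punchIn j x)))
⊢-rename⁻ j (lam M) ρ≗ (⊢lam Γ0 Θ≗ ⊢M) =
  let Γj≡∅ , ⊢M' = ⊢-rename⁻ (suc j) M (ext-punchIn ρ≗) ⊢M
  in ≡.trans (Θ≗ j) Γj≡∅ , ⊢lam Γ0 (Θ≗ ∘ punchIn j) ⊢M'
⊢-rename⁻ j (app M N) ρ≗ (⊢app Γ#Δ Θ≗ ⊢M ⊢N) =
  let Γj≡∅ , ⊢M' = ⊢-rename⁻ j M ρ≗ ⊢M
      Δj≡∅ , ⊢N' = ⊢-rename⁻ j N ρ≗ ⊢N
  in ≡.trans (Θ≗ j) (cong₂ orElse Γj≡∅ Δj≡∅) , ⊢app (Γ#Δ ∘ punchIn j) (Θ≗ ∘ punchIn j) ⊢M' ⊢N'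

⊢var⁻ : ∀ {Θ x t} → Θ ⊢ var x ∶ t → Θ ≗ singleton x t
⊢var⁻ (⊢var _ Θ≗) = Θ≗

⊢-dom⊆FV : ∀ {Θ M t} → Θ ⊢ M ∶ t → ∀ {x u} → Θ x ≡ just u → 1 ≤ occ x M
⊢-dom⊆FV (⊢var x' Θ≗) {x} Θx≡u with x ≟ℕ x'
... | yes refl = occ-var-self x
... | no x≢x'  with () ← ≡.trans (≡.sym Θx≡u) (≡.trans (Θ≗ x) (singleton-other _ x≢x'))
⊢-dom⊆FV (⊢lam Γ0 Θ≗ ⊢M) Θx≡u = ⊢-dom⊆FV ⊢M (≡.trans (≡.sym (Θ≗ _)) Θx≡u)
⊢-dom⊆FV (⊢app {Γ = Γ} {Δ} Γ#Δ Θ≗ ⊢M ⊢N) {x} Θx≡u with orElse-just⁻ (Γ x) (Δ x) (≡.trans (≡.sym (Θ≗ x)) Θx≡u)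
... | inj₁ Γx≡u       = ≤-trans (⊢-dom⊆FV ⊢M Γx≡u) (m≤m+n _ _)
... | inj₂ (_ , Δx≡u) = ≤-trans (⊢-dom⊆FV ⊢N Δx≡u) (m≤n+m _ _)

Strengthens : ℕ → (ℕ → Term) → Set
Strengthens k σ = ∀ x → x ≢ k → σ x ≡ var (punchOut k x)

exts-strengthens : ∀ {k σ} → Strengthens k σ → Strengthens (suc k) (exts σ)
exts-strengthens σ↓ zero    _     = refl
exts-strengthens σ↓ (suc x) sx≢sk = cong (rename suc) (σ↓ x (sx≢sk ∘ cong suc))

subst0-strengthens : ∀ N → Strengthens 0 (subst0 N)
subst0-strengthens N zero    0≢0 = ⊥-elim (0≢0 refl)
subst0-strengthens N (suc x) _   = refl

⊢-subst-absent : ∀ {Γ P t σ} k → Strengthens k σ → Γ k ≡ nothing →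
                 Γ ⊢ P ∶ t → strengthenEnv k Γ ⊢ subst σ P ∶ t
⊢-subst-absent {Γ} {t = t} {σ} k σ↓ Γk≡∅ (⊢var x Γ≗) =
  ≡.subst (λ M → strengthenEnv k Γ ⊢ M ∶ t) (≡.sym (σ↓ x x≢k))
    (⊢var (punchOut k x) λ y → ≡.trans (Γ≗ (punchIn k y)) (strengthenEnv-singleton t x≢k y))
  where
  x≢k : x ≢ k
  x≢k refl with () ← ≡.trans (≡.sym Γk≡∅) (≡.trans (Γ≗ x) (singleton-self x t))
⊢-subst-absent k σ↓ Γk≡∅ (⊢lam Γ0 Θ≗ ⊢M) =
  ⊢lam Γ0 (Θ≗ ∘ punchIn k) (⊢-subst-absent (suc k) (exts-strengthens σ↓) (≡.trans (≡.sym (Θ≗ k)) Γk≡∅) ⊢M)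
⊢-subst-absent k σ↓ Γk≡∅ (⊢app {Γ = A} {B} A#B Θ≗ ⊢M ⊢N) =
  let Ak≡∅ , Bk≡∅ = orElse-nothing⁻ (A k) (B k) (≡.trans (≡.sym (Θ≗ k)) Γk≡∅)
  in ⊢app (A#B ∘ punchIn k) (Θ≗ ∘ punchIn k) (⊢-subst-absent k σ↓ Ak≡∅ ⊢M) (⊢-subst-absent k σ↓ Bk≡∅ ⊢N)

⊢-subst-absent⁻ : ∀ {Θ t σ} k P → Strengthens k σ → occ k P ≡ 0 →
                  Θ ⊢ subst σ P ∶ t → weakenEnv k Θ ⊢ P ∶ t
⊢-subst-absent⁻ {Θ} {t} {σ} k (var x) σ↓ occ≡0 ⊢σx =
  ⊢var x λ y → begin
    weakenEnv k Θ y                            ≡⟨ weakenEnv-cong k Θ≗ y ⟩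
    weakenEnv k (singleton (punchOut k x) t) y ≡⟨ weakenEnv-singleton k (punchOut k x) t y ⟩
    singleton (punchIn k (punchOut k x)) t y   ≡⟨ cong (λ z → singleton z t y) (punchIn-punchOut x≢k) ⟩
    singleton x t y                            ∎
  where
  open ≡.≡-Reasoning
  x≢k : x ≢ k
  x≢k = occ-var≡0⇒≢ occ≡0
  Θ≗ : Θ ≗ singleton (punchOut k x) t
  Θ≗ = ⊢var⁻ (≡.subst (λ M → Θ ⊢ M ∶ t) (σ↓ x x≢k) ⊢σx)
⊢-subst-absent⁻ k (lam P) σ↓ occ≡0 (⊢lam Γ0 Θ≗ ⊢P) =
  ⊢lam Γ0 (weakenEnv-cong k Θ≗) (⊢-subst-absent⁻ (suc k) P (exts-strengthens σ↓) occ≡0 ⊢P)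
⊢-subst-absent⁻ k (app P Q) σ↓ occ≡0 (⊢app {Γ = A} {B} A#B Θ≗ ⊢P ⊢Q) =
  ⊢app (weakenEnv-disjoint k A#B) (λ y → ≡.trans (weakenEnv-cong k Θ≗ y) (weakenEnv-union k A B y))
       (⊢-subst-absent⁻ k P σ↓ (m+n≡0⇒m≡0 (occ k P) occ≡0) ⊢P)
       (⊢-subst-absent⁻ k Q σ↓ (m+n≡0⇒n≡0 (occ k P) occ≡0) ⊢Q)

⊢-subst : ∀ {Γ Δ P N ρ τ σ} k → Strengthens k σ → σ k ≡ N → Γ k ≡ just τ → Δ ⊢ N ∶ τ →
          DisjointDom (strengthenEnv k Γ) Δ → Γ ⊢ P ∶ ρ → union (strengthenEnv k Γ) Δ ⊢ subst σ P ∶ ρ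
⊢-subst {Γ} {Δ} {τ = τ} k σ↓ σk≡N Γk≡τ ⊢N Γ#Δ (⊢var x Γ≗)
  with refl , refl ← singleton-just⁻ (≡.trans (≡.sym (Γ≗ k)) Γk≡τ) =
  ≡.subst (λ M → union (strengthenEnv k Γ) Δ ⊢ M ∶ τ) (≡.sym σk≡N) (⊢-resp-≗ Δ≗ ⊢N)
  where
  Δ≗ : Δ ≗ union (strengthenEnv k Γ) Δ
  Δ≗ y = cong (λ m → orElse m (Δ y))
           (≡.sym (≡.trans (Γ≗ (punchIn k y)) (singleton-other τ (punchInₖ≢k k y))))
⊢-subst {Δ = Δ} k σ↓ σk≡N Γk≡τ ⊢N Γ#Δ (⊢lam {Γ = Γ'} Γ'0 Γ≗ ⊢M) =
  ⊢lam (cong (λ m → orElse m nothing) Γ'0) (λ y → cong (λ m → orElse m (Δ y)) (Γ≗ (punchIn k y)))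
    (⊢-subst (suc k) (exts-strengthens σ↓) (cong (rename suc) σk≡N) (≡.trans (≡.sym (Γ≗ k)) Γk≡τ)
             (⊢-rename⁺ 0 (λ _ → refl) ⊢N) Γ'#Δ ⊢M)
  where
  Γ'#Δ : DisjointDom (strengthenEnv (suc k) Γ') (weakenEnv 0 Δ)
  Γ'#Δ zero    = inj₂ refl
  Γ'#Δ (suc y) = disjoint-resp (λ y → Γ≗ (punchIn k y)) (λ _ → refl) Γ#Δ y
⊢-subst {Δ = Δ} k σ↓ σk≡N Γk≡τ ⊢N Γ#Δ (⊢app {Γ = A} {B} A#B Γ≗ ⊢M ⊢P)
  with AB#Δ ← disjoint-resp (Γ≗ ∘ punchIn k) (λ _ → refl) Γ#Δ
     | orElse-just⁻ (A k) (B k) (≡.trans (≡.sym (Γ≗ k)) Γk≡τ)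
... | inj₁ Ak≡τ = ⊢app (disjoint-union⁺ (A#B ∘ punchIn k) (disjoint-sym B↓#Δ))
                       (λ y → ≡.trans (union-congˡ Δ (Γ≗ ∘ punchIn k) y)
                                      (union-swapʳ (strengthenEnv k A) B↓#Δ y))
                       (⊢-subst k σ↓ σk≡N Ak≡τ ⊢N (disjoint-unionˡ⁻ AB#Δ) ⊢M)
                       (⊢-subst-absent k σ↓ Bk≡∅ ⊢P)
  where
  B↓#Δ : DisjointDom (strengthenEnv k B) Δ
  B↓#Δ = disjoint-unionʳ⁻ AB#Δ
  Bk≡∅ : B k ≡ nothing
  Bk≡∅ with A#B k
  ... | inj₂ Bk≡∅ = Bk≡∅
  ... | inj₁ Ak≡∅ with () ← ≡.trans (≡.sym Ak≡∅) Ak≡τ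
... | inj₂ (Ak≡∅ , Bk≡τ) =
  ⊢app (disjoint-sym (disjoint-union⁺ (disjoint-sym (A#B ∘ punchIn k)) (disjoint-sym (disjoint-unionˡ⁻ AB#Δ))))
       (λ y → ≡.trans (union-congˡ Δ (Γ≗ ∘ punchIn k) y)
                      (union-assoc (strengthenEnv k A) (strengthenEnv k B) Δ y))
       (⊢-subst-absent k σ↓ Ak≡∅ ⊢M)
       (⊢-subst k σ↓ σk≡N Bk≡τ ⊢N (disjoint-unionʳ⁻ AB#Δ) ⊢P)

-- Inversion data for Θ ⊢ P[N/k]: the typings of P and of N it arises from.
record SubstSplit (k : ℕ) (Θ : Env) (P N : Term) (ρ : Ty) : Set where
  field
    {Γ Δ}    : Env
    {τ}      : Ty
    ⊢P       : Γ ⊢ P ∶ ρ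
    Γk≡τ     : Γ k ≡ just τ
    ⊢N       : Δ ⊢ N ∶ τ
    disjoint : DisjointDom (strengthenEnv k Γ) Δ
    split    : Θ ≗ union (strengthenEnv k Γ) Δ

substSplit-appˡ : ∀ {Θ A B k P Q N ρ μ} → DisjointDom A B → Θ ≗ union A B →
                  SubstSplit k A P N (μ ⇒ ρ) → weakenEnv k B ⊢ Q ∶ μ → SubstSplit k Θ (app P Q) N ρ
substSplit-appˡ {Θ} {A} {B} {k} A#B Θ≗ S ⊢Q = record
  { ⊢P       = ⊢app (disjoint-weakenEnv k (disjoint-unionˡ⁻ Γ↓Δ#B)) (λ _ → refl) S.⊢P ⊢Q
  ; Γk≡τ     = cong (λ m → orElse m (weakenEnv k B k)) S.Γk≡τ
  ; ⊢N       = S.⊢N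
  ; disjoint = disjoint-resp (union-congʳ Γ↓ B≗) (λ _ → refl)
                 (disjoint-union⁺ S.disjoint (disjoint-sym Δ#B))
  ; split    = split
  }
  where
  module S = SubstSplit S
  Γ↓ : Env
  Γ↓ = strengthenEnv k S.Γ
  B≗ : B ≗ strengthenEnv k (weakenEnv k B)
  B≗ y = ≡.sym (strengthenEnv-weakenEnv k B y)
  Γ↓Δ#B : DisjointDom (union Γ↓ S.Δ) B
  Γ↓Δ#B = disjoint-resp S.split (λ _ → refl) A#B
  Δ#B : DisjointDom S.Δ B
  Δ#B = disjoint-unionʳ⁻ Γ↓Δ#B
  split : Θ ≗ union (union Γ↓ (strengthenEnv k (weakenEnv k B))) S.Δ
  split y = begin
    Θ y                           ≡⟨ Θ≗ y ⟩
    union A B y                   ≡⟨ union-congˡ B S.split y ⟩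
    union (union Γ↓ S.Δ) B y      ≡⟨ union-swapʳ Γ↓ Δ#B y ⟩
    union (union Γ↓ B) S.Δ y      ≡⟨ union-congˡ S.Δ (union-congʳ Γ↓ B≗) y ⟩
    union (union Γ↓ (strengthenEnv k (weakenEnv k B))) S.Δ y ∎
    where open ≡.≡-Reasoning

substSplit-appʳ : ∀ {Θ A B k P Q N ρ μ} → DisjointDom A B → Θ ≗ union A B →
                  weakenEnv k A ⊢ P ∶ μ ⇒ ρ → SubstSplit k B Q N μ → SubstSplit k Θ (app P Q) N ρ
substSplit-appʳ {Θ} {A} {B} {k} A#B Θ≗ ⊢P S = record
  { ⊢P       = ⊢app (disjoint-sym (disjoint-weakenEnv k (disjoint-unionˡ⁻ Γ↓Δ#A))) (λ _ → refl) ⊢P S.⊢P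
  ; Γk≡τ     = ≡.trans (cong (λ m → orElse m (S.Γ k)) (weakenEnv-self k A)) S.Γk≡τ
  ; ⊢N       = S.⊢N
  ; disjoint = disjoint-resp (union-congˡ Γ↓ A≗) (λ _ → refl)
                 (disjoint-union⁺ (disjoint-sym (disjoint-unionʳ⁻ Γ↓Δ#A)) S.disjoint)
  ; split    = split
  }
  where
  module S = SubstSplit S
  Γ↓ : Env
  Γ↓ = strengthenEnv k S.Γ
  A≗ : A ≗ strengthenEnv k (weakenEnv k A)
  A≗ y = ≡.sym (strengthenEnv-weakenEnv k A y)
  Γ↓Δ#A : DisjointDom (union Γ↓ S.Δ) A
  Γ↓Δ#A = disjoint-resp S.split (λ _ → refl) (disjoint-sym A#B)
  split : Θ ≗ union (union (strengthenEnv k (weakenEnv k A)) Γ↓) S.Δ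
  split y = begin
    Θ y                           ≡⟨ Θ≗ y ⟩
    union A B y                   ≡⟨ union-congʳ A S.split y ⟩
    union A (union Γ↓ S.Δ) y      ≡⟨ union-assoc A Γ↓ S.Δ y ⟨
    union (union A Γ↓) S.Δ y      ≡⟨ union-congˡ S.Δ (union-congˡ Γ↓ A≗) y ⟩
    union (union (strengthenEnv k (weakenEnv k A)) Γ↓) S.Δ y ∎
    where open ≡.≡-Reasoning

⊢-subst⁻ : ∀ {Θ N ρ σ} k P → Strengthens k σ → σ k ≡ N → occ k P ≡ 1 →
           Θ ⊢ subst σ P ∶ ρ → SubstSplit k Θ P N ρ
⊢-subst⁻ {Θ} {ρ = ρ} k (var x) σ↓ σk≡N occ≡1 ⊢σx with refl ← occ-var≡1⇒≡ occ≡1 = record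
  { ⊢P       = ⊢var k λ _ → refl
  ; Γk≡τ     = singleton-self k ρ
  ; ⊢N       = ≡.subst (λ M → Θ ⊢ M ∶ ρ) σk≡N ⊢σx
  ; disjoint = λ y → inj₁ (k∉ y)
  ; split    = λ y → cong (λ m → orElse m (Θ y)) (≡.sym (k∉ y))
  }
  where
  k∉ : ∀ y → singleton k ρ (punchIn k y) ≡ nothing
  k∉ y = singleton-other ρ (punchInₖ≢k k y)
⊢-subst⁻ {N = N} k (lam P) σ↓ σk≡N occ≡1 (⊢lam Γ0 Θ≗ ⊢P)
  with S ← ⊢-subst⁻ (suc k) P (exts-strengthens σ↓) (cong (rename suc) σk≡N) occ≡1 ⊢P
  with Δ0≡∅ , ⊢N ← ⊢-rename⁻ 0 N (λ _ → refl) (SubstSplit.⊢N S) = record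
  { ⊢P       = ⊢lam Γ'0 (λ _ → refl) S.⊢P
  ; Γk≡τ     = S.Γk≡τ
  ; ⊢N       = ⊢N
  ; disjoint = S.disjoint ∘ suc
  ; split    = λ y → ≡.trans (Θ≗ y) (S.split (suc y))
  }
  where
  module S = SubstSplit S
  Γ'0 : S.Γ 0 ≡ just _
  Γ'0 = ≡.trans (≡.sym (orElse-nothingʳ (S.Γ 0)))
          (≡.trans (cong (orElse (S.Γ 0)) (≡.sym Δ0≡∅)) (≡.trans (≡.sym (S.split 0)) Γ0))
⊢-subst⁻ k (app P Q) σ↓ σk≡N occ≡1 (⊢app A#B Θ≗ ⊢P ⊢Q) with m+n≡1-cases (occ k P) occ≡1
... | inj₁ (occP≡1 , occQ≡0) =
  substSplit-appˡ A#B Θ≗ (⊢-subst⁻ k P σ↓ σk≡N occP≡1 ⊢P) (⊢-subst-absent⁻ k Q σ↓ occQ≡0 ⊢Q)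
... | inj₂ (occP≡0 , occQ≡1) =
  substSplit-appʳ A#B Θ≗ (⊢-subst-absent⁻ k P σ↓ occP≡0 ⊢P) (⊢-subst⁻ k Q σ↓ σk≡N occQ≡1 ⊢Q)

⊢-β : ∀ {Θ P N t} → Θ ⊢ app (lam P) N ∶ t → Θ ⊢ P [ N ] ∶ t
⊢-β {N = N} (⊢app {Δ = Δ} A#Δ Θ≗ (⊢lam Γ0 A≗ ⊢P) ⊢N) =
  ⊢-resp-≗ (λ y → ≡.sym (≡.trans (Θ≗ y) (union-congˡ Δ A≗ y)))
    (⊢-subst 0 (subst0-strengthens N) refl Γ0 ⊢N (disjoint-resp A≗ (λ _ → refl) A#Δ) ⊢P)

⊢-β⁻ : ∀ {Θ P N t} → occ 0 P ≡ 1 → Θ ⊢ P [ N ] ∶ t → Θ ⊢ app (lam P) N ∶ t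
⊢-β⁻ {P = P} {N} occ≡1 ⊢P[N] =
  ⊢app S.disjoint S.split (⊢lam S.Γk≡τ (λ _ → refl) S.⊢P) S.⊢N
  where module S = SubstSplit (⊢-subst⁻ 0 P (subst0-strengthens N) refl occ≡1 ⊢P[N])

⊢lam-cong : ∀ {Θ M M' t} → (∀ {Γ ν} → Γ ⊢ M ∶ ν → Γ ⊢ M' ∶ ν) → Θ ⊢ lam M ∶ t → Θ ⊢ lam M' ∶ t
⊢lam-cong M⇒M' (⊢lam Γ0 Θ≗ ⊢M) = ⊢lam Γ0 Θ≗ (M⇒M' ⊢M)

⊢app-cong : ∀ {Θ M M' N N' t} → (∀ {Γ ν} → Γ ⊢ M ∶ ν → Γ ⊢ M' ∶ ν) → (∀ {Δ μ} → Δ ⊢ N ∶ μ → Δ ⊢ N' ∶ μ) →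
            Θ ⊢ app M N ∶ t → Θ ⊢ app M' N' ∶ t
⊢app-cong M⇒M' N⇒N' (⊢app Γ#Δ Θ≗ ⊢M ⊢N) = ⊢app Γ#Δ Θ≗ (M⇒M' ⊢M) (N⇒N' ⊢N)

open Equivalence using (to; from)

⊢-resp-=βL : ∀ {M M'} → M =βL M' → ∀ {Θ t} → Θ ⊢ M ∶ t ⇔ Θ ⊢ M' ∶ t
⊢-resp-=βL (beta (lam occ≡1 _) _) = mk⇔ ⊢-β (⊢-β⁻ occ≡1)
⊢-resp-=βL (xi _ _ M=M')          = mk⇔ (⊢lam-cong (to (⊢-resp-=βL M=M'))) (⊢lam-cong (from (⊢-resp-=βL M=M')))
⊢-resp-=βL (appC M=M' N=N')       =
  mk⇔ (⊢app-cong (to (⊢-resp-=βL M=M')) (to (⊢-resp-=βL N=N')))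
      (⊢app-cong (from (⊢-resp-=βL M=M')) (from (⊢-resp-=βL N=N')))
⊢-resp-=βL refl                   = ⇔.refl
⊢-resp-=βL (sym M=M')             = ⇔.sym (⊢-resp-=βL M=M')
⊢-resp-=βL (trans M=N N=P)        = ⇔.trans (⊢-resp-=βL M=N) (⊢-resp-=βL N=P)

applyEnv-disjoint : ∀ S {A B} → DisjointDom A B → DisjointDom (applyEnv S A) (applyEnv S B)
applyEnv-disjoint S A#B y = [ inj₁ ∘ cong (mapMaybe (applyT S)) , inj₂ ∘ cong (mapMaybe (applyT S)) ]′ (A#B y)

applyEnv-union : ∀ S A B → applyEnv S (union A B) ≗ union (applyEnv S A) (applyEnv S B)
applyEnv-union S A B y = mapMaybe-orElse (applyT S) (A y) (B y)

⊢-applyT : ∀ S {Γ M t} → Γ ⊢ M ∶ t → applyEnv S Γ ⊢ M ∶ applyT S t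
⊢-applyT S {t = t} (⊢var x Γ≗) =
  ⊢var x λ y → ≡.trans (cong (mapMaybe (applyT S)) (Γ≗ y)) (mapMaybe-singleton (applyT S) x t y)
⊢-applyT S (⊢lam Γ0 Θ≗ ⊢M) =
  ⊢lam (cong (mapMaybe (applyT S)) Γ0) (cong (mapMaybe (applyT S)) ∘ Θ≗) (⊢-applyT S ⊢M)
⊢-applyT S (⊢app {Γ = A} {B} A#B Θ≗ ⊢M ⊢N) =
  ⊢app (applyEnv-disjoint S A#B) (λ y → ≡.trans (cong (mapMaybe (applyT S)) (Θ≗ y)) (applyEnv-union S A B y))
       (⊢-applyT S ⊢M) (⊢-applyT S ⊢N)

mgu-fixes-fresh : ∀ {U s t} u → IsMGU U s t → (∀ a → a occursIn u → ¬ a occursIn s × ¬ a occursIn t) →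
                  applyT U u ≡ u
mgu-fixes-fresh u m fresh = applyT-identity u λ a a∈u → let a∉s , a∉t = fresh a a∈u in IsMGU.support m a a∉s a∉t

record FreshApp (Γ : Env) (μ : Ty) (Δ : Env) (τ : Ty) (α β : ℕ) : Set where
  constructor freshApp
  field
    disjointTV : ∀ a → a ∈TV⟨ Γ , μ ⟩ → ¬ a ∈TV⟨ Δ , τ ⟩
    α≢β        : α ≢ β
    α∉Γμ       : ¬ α ∈TV⟨ Γ , μ ⟩
    α∉Δτ       : ¬ α ∈TV⟨ Δ , τ ⟩
    β∉Γμ       : ¬ β ∈TV⟨ Γ , μ ⟩
    β∉Δτ       : ¬ β ∈TV⟨ Δ , τ ⟩

  -- τ shares no variable with μ → α → β, so the first unifier leaves it alone.
  mgu-fixes-τ : ∀ {U'} → IsMGU U' μ (tvar α ⇒ tvar β) → applyT U' τ ≡ τ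
  mgu-fixes-τ m = mgu-fixes-fresh τ m λ a a∈τ →
    (λ a∈μ → disjointTV a (inj₂ a∈μ) (inj₂ a∈τ)) ,
    λ { (left here) → α∉Δτ (inj₂ a∈τ) ; (right here) → β∉Δτ (inj₂ a∈τ) }

⊩L⇒⊢ : ∀ {Θ M σ} → Θ ⊩L M ∶ σ → Θ ⊢ M ∶ σ
⊩L⇒⊢ (var x a Θ≗ refl)         = ⊢var x Θ≗
⊩L⇒⊢ (lam _ ⊩M Γ0 Θ≗ refl)     = ⊢lam Γ0 Θ≗ (⊩L⇒⊢ ⊩M)
⊩L⇒⊢ (app {Γ = Γ} {Δ} {μ = μ} {τ} α β U' U ⊩M ⊩N Γ#Δ disjointTV α≢β α∉Γμ α∉Δτ β∉Γμ β∉Δτ m₁ m₂ Θ≗ refl) =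
  ⊢app (applyEnv-disjoint (U ∘ₛ U') Γ#Δ) (λ y → ≡.trans (Θ≗ y) (applyEnv-union (U ∘ₛ U') Γ Δ y))
       (≡.subst (applyEnv (U ∘ₛ U') Γ ⊢ _ ∶_) Uμ≡ (⊢-applyT (U ∘ₛ U') (⊩L⇒⊢ ⊩M)))
       (≡.subst (applyEnv (U ∘ₛ U') Δ ⊢ _ ∶_) Uτ≡ (⊢-applyT (U ∘ₛ U') (⊩L⇒⊢ ⊩N)))
  where
  Uμ≡ : applyT (U ∘ₛ U') μ ≡ applyT U (U' α) ⇒ applyT U (U' β)
  Uμ≡ = ≡.trans (applyT-∘ U U' μ) (cong (applyT U) (IsMGU.unifies m₁))
  Uτ≡ : applyT (U ∘ₛ U') τ ≡ applyT U (U' α)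
  Uτ≡ = ≡.trans (applyT-∘ U U' τ)
          (≡.trans (cong (applyT U) (FreshApp.mgu-fixes-τ (freshApp disjointTV α≢β α∉Γμ α∉Δτ β∉Γμ β∉Δτ) m₁))
                   (≡.sym (IsMGU.unifies m₂)))

⊢-dom-bounded : ∀ {Θ M t} → Θ ⊢ M ∶ t → ∃ λ n → ∀ x → n ≤ x → Θ x ≡ nothing
⊢-dom-bounded (⊢var x Θ≗) = suc x , λ y x<y → ≡.trans (Θ≗ y) (singleton-other _ λ { refl → n≮n x x<y })
⊢-dom-bounded (⊢lam Γ0 Θ≗ ⊢M) with n , bound ← ⊢-dom-bounded ⊢M =
  n , λ y n≤y → ≡.trans (Θ≗ y) (bound (suc y) (m≤n⇒m≤1+n n≤y))
⊢-dom-bounded (⊢app Γ#Δ Θ≗ ⊢M ⊢N) with n₁ , bound₁ ← ⊢-dom-bounded ⊢M | n₂ , bound₂ ← ⊢-dom-bounded ⊢N =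
  n₁ ⊔ n₂ , λ y n≤y → ≡.trans (Θ≗ y)
    (cong₂ orElse (bound₁ y (≤-trans (m≤m⊔n n₁ n₂) n≤y)) (bound₂ y (≤-trans (m≤n⊔m n₁ n₂) n≤y)))

envTyVars : Env → ℕ → List ℕ
envTyVars Γ zero    = []
envTyVars Γ (suc n) = envTyVars Γ n ++ maybe′ tyVars [] (Γ n)

∈-envTyVars⁻ : ∀ {a} Γ n → a ∈ envTyVars Γ n → a ∈TV Γ
∈-envTyVars⁻ Γ (suc n) a∈ with ∈-++⁻ (envTyVars Γ n) a∈
... | inj₁ a∈Γ<n = ∈-envTyVars⁻ Γ n a∈Γ<n
... | inj₂ a∈Γn with Γ n in Γn≡
...   | just t = n , t , Γn≡ , ∈-tyVars⁻ t a∈Γn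

∈-envTyVars⁺ : ∀ {a} Γ n → (∀ x → n ≤ x → Γ x ≡ nothing) → a ∈TV Γ → a ∈ envTyVars Γ n
∈-envTyVars⁺ Γ n bound (x , t , Γx≡t , a∈t) = below n x<n
  where
  x<n : x < n
  x<n with x <? n
  ... | yes x<n = x<n
  ... | no x≮n  with () ← ≡.trans (≡.sym Γx≡t) (bound x (≮⇒≥ x≮n))
  below : ∀ m → x < m → _ ∈ envTyVars Γ m
  below (suc m) (s≤s x≤m) with m≤n⇒m<n∨m≡n x≤m
  ... | inj₁ x<m  = ∈-++⁺ˡ (below m x<m)
  ... | inj₂ refl = ∈-++⁺ʳ (envTyVars Γ x)
                      (≡.subst (λ m → _ ∈ maybe′ tyVars [] m) (≡.sym Γx≡t) (∈-tyVars⁺ t a∈t))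

⊢-tyVars : ∀ {Γ M σ} → Γ ⊢ M ∶ σ → ∃ λ Vs → ∀ a → a ∈TV⟨ Γ , σ ⟩ ⇔ a ∈ Vs
⊢-tyVars {Γ} {σ = σ} ⊢M with n , bound ← ⊢-dom-bounded ⊢M =
  tyVars σ ++ envTyVars Γ n , λ a → mk⇔
    [ ∈-++⁺ʳ (tyVars σ) ∘ ∈-envTyVars⁺ Γ n bound , ∈-++⁺ˡ ∘ ∈-tyVars⁺ σ ]′
    λ a∈ → [ inj₂ ∘ ∈-tyVars⁻ σ , inj₁ ∘ ∈-envTyVars⁻ Γ n ]′ (∈-++⁻ (tyVars σ) a∈)

⊢-∈TV? : ∀ {Γ M σ} → Γ ⊢ M ∶ σ → ∀ a → Dec (a ∈TV⟨ Γ , σ ⟩)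
⊢-∈TV? ⊢M a with Vs , a∈TV⇔ ← ⊢-tyVars ⊢M = mapDec (⇔.sym (a∈TV⇔ a)) (a ∈? Vs)

-- Principality

IsInstance : TySubst → Env → Ty → Env → Ty → Set
IsInstance S Γ σ Γ₀ σ₀ = Γ₀ ≗ applyEnv S Γ × σ₀ ≡ applyT S σ

applyEnv-cong : ∀ {S S'} Γ → (∀ a → a ∈TV Γ → S a ≡ S' a) → applyEnv S Γ ≗ applyEnv S' Γ
applyEnv-cong Γ S≗S' x with Γ x in Γx≡
... | nothing = refl
... | just t  = cong just (applyT-cong t λ a a∈t → S≗S' a (x , t , Γx≡ , a∈t))

applyEnv-factor : ∀ {V W U} → (∀ a → V a ≡ applyT W (U a)) → ∀ Γ → applyEnv V Γ ≗ applyEnv W (applyEnv U Γ)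
applyEnv-factor V≗WU Γ x = ≡.trans (mapMaybe-cong (applyT-factor V≗WU) (Γ x)) (mapMaybe-∘ (Γ x))

module _ {Γ μ Δ τ α β} (fresh : FreshApp Γ μ Δ τ α β) (dec : ∀ a → Dec (a ∈TV⟨ Γ , μ ⟩)) where
  open FreshApp fresh

  -- One substitution acting as S₁ on the function part, as S₂ on the argument
  -- part, and sending α, β to given types; possible since these are disjoint.
  glue : TySubst → TySubst → Ty → Ty → TySubst
  glue S₁ S₂ μ₀ ν₀ a with a ≟ℕ α | a ≟ℕ β | dec a
  ... | yes _ | _     | _     = μ₀
  ... | no _  | yes _ | _     = ν₀
  ... | no _  | no _  | yes _ = S₁ a
  ... | no _  | no _  | no _  = S₂ a

  module _ (S₁ S₂ : TySubst) (μ₀ ν₀ : Ty) where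
    glue-α : glue S₁ S₂ μ₀ ν₀ α ≡ μ₀
    glue-α with α ≟ℕ α
    ... | yes _  = refl
    ... | no α≢α = ⊥-elim (α≢α refl)

    glue-β : glue S₁ S₂ μ₀ ν₀ β ≡ ν₀
    glue-β with β ≟ℕ α | β ≟ℕ β
    ... | yes β≡α | _      = ⊥-elim (α≢β (≡.sym β≡α))
    ... | no _    | yes _  = refl
    ... | no _    | no β≢β = ⊥-elim (β≢β refl)

    glue-Γμ : ∀ a → a ∈TV⟨ Γ , μ ⟩ → glue S₁ S₂ μ₀ ν₀ a ≡ S₁ a
    glue-Γμ a a∈ with a ≟ℕ α | a ≟ℕ β | dec a
    ... | yes refl | _        | _      = ⊥-elim (α∉Γμ a∈)
    ... | no _     | yes refl | _      = ⊥-elim (β∉Γμ a∈)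
    ... | no _     | no _     | yes _  = refl
    ... | no _     | no _     | no a∉  = ⊥-elim (a∉ a∈)

    glue-Δτ : ∀ a → a ∈TV⟨ Δ , τ ⟩ → glue S₁ S₂ μ₀ ν₀ a ≡ S₂ a
    glue-Δτ a a∈ with a ≟ℕ α | a ≟ℕ β | dec a
    ... | yes refl | _        | _       = ⊥-elim (α∉Δτ a∈)
    ... | no _     | yes refl | _       = ⊥-elim (β∉Δτ a∈)
    ... | no _     | no _     | yes a∈' = ⊥-elim (disjointTV a a∈' a∈)
    ... | no _     | no _     | no _    = refl

    glue-unifies : μ₀ ⇒ ν₀ ≡ applyT S₁ μ → Unifies (glue S₁ S₂ μ₀ ν₀) μ (tvar α ⇒ tvar β)
    glue-unifies μ₀⇒ν₀≡ = ≡.trans (applyT-cong μ λ a → glue-Γμ a ∘ inj₂)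
                                 (≡.trans (≡.sym μ₀⇒ν₀≡) (≡.sym (cong₂ _⇒_ glue-α glue-β)))

    glue-τ : μ₀ ≡ applyT S₂ τ → applyT (glue S₁ S₂ μ₀ ν₀) τ ≡ glue S₁ S₂ μ₀ ν₀ α
    glue-τ μ₀≡ = ≡.trans (applyT-cong τ λ a → glue-Δτ a ∘ inj₂) (≡.trans (≡.sym μ₀≡) (≡.sym glue-α))

mgu-step : ∀ {μ τ α β U' V} → IsMGU U' μ (tvar α ⇒ tvar β) → applyT U' τ ≡ τ →
           Unifies V μ (tvar α ⇒ tvar β) → applyT V τ ≡ V α →
           ∃ λ W → (∀ a → V a ≡ applyT W (U' a)) × Unifies W (U' α) τ
mgu-step {τ = τ} {α} {U' = U'} {V} m U'τ≡τ Vμ≡ Vτ≡Vα with W , V≗WU' ← IsMGU.general m V Vμ≡ =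
  W , V≗WU' , (begin
    applyT W (U' α)          ≡⟨ V≗WU' α ⟨
    V α                      ≡⟨ Vτ≡Vα ⟨
    applyT V τ               ≡⟨ applyT-factor V≗WU' τ ⟩
    applyT W (applyT U' τ)   ≡⟨ cong (applyT W) U'τ≡τ ⟩
    applyT W τ               ∎)
  where open ≡.≡-Reasoning

∘-mgu-general : ∀ {μ τ α β U' U V} → IsMGU U' μ (tvar α ⇒ tvar β) → IsMGU U (U' α) τ → applyT U' τ ≡ τ →
                Unifies V μ (tvar α ⇒ tvar β) → applyT V τ ≡ V α →
                ∃ λ W → ∀ a → V a ≡ applyT W ((U ∘ₛ U') a)
∘-mgu-general {U' = U'} {U} m₁ m₂ U'τ≡τ Vμ≡ Vτ≡Vα
  with W₁ , V≗W₁U' , W₁-unifies ← mgu-step m₁ U'τ≡τ Vμ≡ Vτ≡Vα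
  with W , W₁≗WU ← IsMGU.general m₂ W₁ W₁-unifies =
  W , λ a → ≡.trans (V≗W₁U' a) (applyT-factor W₁≗WU (U' a))

⊩L-principal : ∀ {Θ M σ Θ₀ σ₀} → Θ ⊩L M ∶ σ → Θ₀ ⊢ M ∶ σ₀ → ∃ λ S → IsInstance S Θ σ Θ₀ σ₀
⊩L-principal {σ₀ = σ₀} (var x a Θ≗ refl) (⊢var _ Θ₀≗) =
  S , (λ y → ≡.trans (Θ₀≗ y) (≡.sym (≡.trans (cong (mapMaybe (applyT S)) (Θ≗ y))
                                              (mapMaybe-singleton (applyT S) x (tvar a) y)))) , refl
  where
  S : TySubst
  S _ = σ₀
⊩L-principal {Θ} (lam _ ⊩M Γ0 Θ≗ refl) (⊢lam Γ₀0 Θ₀≗ ⊢M) with S , Γ₀≗ , ν₀≡ ← ⊩L-principal ⊩M ⊢M =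
  S , (λ y → ≡.trans (Θ₀≗ y) (≡.trans (Γ₀≗ (suc y)) (cong (mapMaybe (applyT S)) (≡.sym (Θ≗ y))))) ,
  cong₂ _⇒_ (just-injective (≡.trans (≡.sym Γ₀0) (≡.trans (Γ₀≗ 0) (cong (mapMaybe (applyT S)) Γ0)))) ν₀≡
⊩L-principal {Θ} {Θ₀ = Θ₀} (app {Γ = Γ} {Δ} α β U' U ⊩M ⊩N _ disjointTV α≢β α∉Γμ α∉Δτ β∉Γμ β∉Δτ m₁ m₂ Θ≗ refl)
                           (⊢app {Γ = Γ₀} {Δ₀} {μ = μ₀} {ν₀} _ Θ₀≗ ⊢M ⊢N)
  with S₁ , Γ₀≗ , μ₀⇒ν₀≡ ← ⊩L-principal ⊩M ⊢M | S₂ , Δ₀≗ , μ₀≡ ← ⊩L-principal ⊩N ⊢N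
  with fresh ← freshApp disjointTV α≢β α∉Γμ α∉Δτ β∉Γμ β∉Δτ
  with dec ← ⊢-∈TV? (⊩L⇒⊢ ⊩M)
  with W , V≗WU ← ∘-mgu-general m₁ m₂ (FreshApp.mgu-fixes-τ fresh m₁)
                    (glue-unifies fresh dec S₁ S₂ μ₀ ν₀ μ₀⇒ν₀≡) (glue-τ fresh dec S₁ S₂ μ₀ ν₀ μ₀≡) =
  W , Θ₀≗WΘ , ≡.trans (≡.sym (glue-β fresh dec S₁ S₂ μ₀ ν₀)) (V≗WU β)
  where
  V : TySubst
  V = glue fresh dec S₁ S₂ μ₀ ν₀
  Θ₀≗WΘ : Θ₀ ≗ applyEnv W Θ
  Θ₀≗WΘ y = begin
    Θ₀ y                                              ≡⟨ Θ₀≗ y ⟩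
    union Γ₀ Δ₀ y                                     ≡⟨ union-cong Γ₀≗ Δ₀≗ y ⟩
    union (applyEnv S₁ Γ) (applyEnv S₂ Δ) y           ≡⟨ union-cong V≗S₁ V≗S₂ y ⟨
    union (applyEnv V Γ) (applyEnv V Δ) y             ≡⟨ applyEnv-union V Γ Δ y ⟨
    applyEnv V (union Γ Δ) y                          ≡⟨ applyEnv-factor V≗WU (union Γ Δ) y ⟩
    applyEnv W (applyEnv (U ∘ₛ U') (union Γ Δ)) y     ≡⟨ cong (mapMaybe (applyT W)) (Θ≗ y) ⟨
    applyEnv W Θ y                                    ∎
    where
    open ≡.≡-Reasoning
    V≗S₁ : applyEnv V Γ ≗ applyEnv S₁ Γ
    V≗S₁ = applyEnv-cong Γ λ a → glue-Γμ fresh dec S₁ S₂ μ₀ ν₀ a ∘ inj₁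
    V≗S₂ : applyEnv V Δ ≗ applyEnv S₂ Δ
    V≗S₂ = applyEnv-cong Δ λ a → glue-Δτ fresh dec S₁ S₂ μ₀ ν₀ a ∘ inj₁

-- Existence of principal typings with type variables in a given range

AllVars : (ℕ → Set) → Ty → Set
AllVars P t = ∀ a → a occursIn t → P a

Keeps : (ℕ → Set) → TySubst → Set
Keeps P U = ∀ a → P a → AllVars P (U a)

applyT-keeps : ∀ {P U} → Keeps P U → ∀ t → AllVars P t → AllVars P (applyT U t)
applyT-keeps U-keeps t t⊆P c c∈Ut with d , d∈t , c∈Ud ← occursIn-applyT⁻ t c∈Ut = U-keeps d (t⊆P d d∈t) c c∈Ud

∘ₛ-keeps : ∀ {P U U'} → Keeps P U → Keeps P U' → Keeps P (U ∘ₛ U')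
∘ₛ-keeps U-keeps U'-keeps a Pa = applyT-keeps U-keeps _ (U'-keeps a Pa)

mgu-keeps : ∀ {P U s t} → IsMGU U s t → (∀ b → b occursIn s ⊎ b occursIn t → P b) → Keeps P U
mgu-keeps {U = U} {s} {t} m st⊆P a Pa c c∈Ua with a occursIn? s | a occursIn? t
... | yes a∈s | _       = st⊆P c (IsMGU.noNewVars m a c c∈Ua (inj₁ a∈s))
... | no _    | yes a∈t = st⊆P c (IsMGU.noNewVars m a c c∈Ua (inj₂ a∈t))
... | no a∉s  | no a∉t  with here ← ≡.subst (c occursIn_) (IsMGU.support m a a∉s a∉t) c∈Ua = Pa

∈TV-applyEnv⁻ : ∀ {S Γ a} → a ∈TV applyEnv S Γ → ∃ λ b → b ∈TV Γ × a occursIn S b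
∈TV-applyEnv⁻ {S} {Γ} (x , t' , SΓx≡t' , a∈t') with Γ x in Γx≡
... | just t with refl ← just-injective SΓx≡t' with b , b∈t , a∈Sb ← occursIn-applyT⁻ t a∈t' =
  b , (x , t , Γx≡ , b∈t) , a∈Sb

∈TV-union⁻ : ∀ {Γ Δ a} → a ∈TV union Γ Δ → a ∈TV Γ ⊎ a ∈TV Δ
∈TV-union⁻ {Γ} {Δ} (x , t , Γ∪Δx≡t , a∈t) with orElse-just⁻ (Γ x) (Δ x) Γ∪Δx≡t
... | inj₁ Γx≡t       = inj₁ (x , t , Γx≡t , a∈t)
... | inj₂ (_ , Δx≡t) = inj₂ (x , t , Δx≡t , a∈t)

disjoint-applyEnv⁻ : ∀ {S S' A B} → DisjointDom (applyEnv S A) (applyEnv S' B) → DisjointDom A B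
disjoint-applyEnv⁻ {A = A} {B} SA#S'B x =
  [ inj₁ ∘ mapMaybe-nothing⁻ (A x) , inj₂ ∘ mapMaybe-nothing⁻ (B x) ]′ (SA#S'B x)
  where
  mapMaybe-nothing⁻ : ∀ {f : Ty → Ty} m → mapMaybe f m ≡ nothing → m ≡ nothing
  mapMaybe-nothing⁻ nothing _ = refl

InRange : ℕ → ℕ → ℕ → Set
InRange K L a = K ≤ a × a < L

record BoundedPrincipal (K : ℕ) (M : Term) : Set where
  field
    {Θ}     : Env
    {σ}     : Ty
    L       : ℕ
    K≤L     : K ≤ L
    ⊩M      : Θ ⊩L M ∶ σ
    bounded : ∀ a → a ∈TV⟨ Θ , σ ⟩ → InRange K L a

module _ {K M N} (BM : BoundedPrincipal K M) (BN : BoundedPrincipal (BoundedPrincipal.L BM) N) where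
  private
    module BM = BoundedPrincipal BM
    module BN = BoundedPrincipal BN

  -- M's variables lie in [K, L₁), N's in [L₁, L₂); α and β are chosen above both.
  private
    α β L : ℕ
    α = BN.L
    β = suc α
    L = suc β

    Γμ<α : ∀ {a} → a ∈TV⟨ BM.Θ , BM.σ ⟩ → a < α
    Γμ<α a∈ = <-≤-trans (proj₂ (BM.bounded _ a∈)) BN.K≤L

    Δτ<α : ∀ {a} → a ∈TV⟨ BN.Θ , BN.σ ⟩ → a < α
    Δτ<α a∈ = proj₂ (BN.bounded _ a∈)

    <α⇒≢β : ∀ {a} → a < α → a ≢ β
    <α⇒≢β a<α refl = n≮n α (<-trans (n<1+n α) a<α)

    fresh : FreshApp BM.Θ BM.σ BN.Θ BN.σ α β
    fresh = freshApp (λ a a∈Γμ a∈Δτ → n≮n a (<-≤-trans (proj₂ (BM.bounded a a∈Γμ)) (proj₁ (BN.bounded a a∈Δτ))))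
                     (<⇒≢ (n<1+n α))
                     (λ α∈ → <⇒≢ (Γμ<α α∈) refl) (λ α∈ → <⇒≢ (Δτ<α α∈) refl)
                     (λ β∈ → <α⇒≢β (Γμ<α β∈) refl) (λ β∈ → <α⇒≢β (Δτ<α β∈) refl)

    P : ℕ → Set
    P = InRange K L

    <α⇒<L : ∀ {a} → a < α → a < L
    <α⇒<L a<α = <-trans a<α (<-trans (n<1+n α) (n<1+n β))

    K≤α : K ≤ α
    K≤α = ≤-trans BM.K≤L BN.K≤L

    Pα : P α
    Pα = K≤α , <-trans (n<1+n α) (n<1+n β)

    Pβ : P β
    Pβ = ≤-trans K≤α (n≤1+n α) , n<1+n β

    PΓμ : ∀ a → a ∈TV⟨ BM.Θ , BM.σ ⟩ → P a
    PΓμ a a∈ = proj₁ (BM.bounded a a∈) , <α⇒<L (Γμ<α a∈)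

    PΔτ : ∀ a → a ∈TV⟨ BN.Θ , BN.σ ⟩ → P a
    PΔτ a a∈ = ≤-trans BM.K≤L (proj₁ (BN.bounded a a∈)) , <α⇒<L (Δτ<α a∈)

  boundedPrincipal-app : ∀ {S₁ S₂ Γ₀ Δ₀ μ₀ ν₀} → IsInstance S₁ BM.Θ BM.σ Γ₀ (μ₀ ⇒ ν₀) →
                         IsInstance S₂ BN.Θ BN.σ Δ₀ μ₀ → DisjointDom Γ₀ Δ₀ → BoundedPrincipal K (app M N)
  boundedPrincipal-app {S₁} {S₂} {μ₀ = μ₀} {ν₀} (Γ₀≗ , μ₀⇒ν₀≡) (Δ₀≗ , μ₀≡) Γ₀#Δ₀
    with dec ← ⊢-∈TV? (⊩L⇒⊢ BM.⊩M)
    with V-unifies ← glue-unifies fresh dec S₁ S₂ μ₀ ν₀ μ₀⇒ν₀≡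
    with U' , m₁ ← mgu BM.σ (tvar α ⇒ tvar β) _ V-unifies
    with W₁ , _ , W₁-unifies ← mgu-step m₁ (FreshApp.mgu-fixes-τ fresh m₁) V-unifies
                                          (glue-τ fresh dec S₁ S₂ μ₀ ν₀ μ₀≡)
    with U , m₂ ← mgu (U' α) BN.σ W₁ W₁-unifies = record
    { L       = L
    ; K≤L     = ≤-trans (proj₁ Pβ) (n≤1+n β)
    ; ⊩M      = app α β U' U BM.⊩M BN.⊩M (disjoint-applyEnv⁻ (disjoint-resp Γ₀≗ Δ₀≗ Γ₀#Δ₀))
                    disjointTV α≢β α∉Γμ α∉Δτ β∉Γμ β∉Δτ m₁ m₂ (λ _ → refl) refl
    ; bounded = bounded
    }
    where
    open FreshApp fresh
    U'-keeps : Keeps P U'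
    U'-keeps = mgu-keeps m₁ λ { b (inj₁ b∈μ)          → PΓμ b (inj₂ b∈μ)
                              ; b (inj₂ (left here))  → Pα
                              ; b (inj₂ (right here)) → Pβ }
    UU'-keeps : Keeps P (U ∘ₛ U')
    UU'-keeps = ∘ₛ-keeps (mgu-keeps m₂ λ { b (inj₁ b∈U'α) → U'-keeps α Pα b b∈U'α
                                         ; b (inj₂ b∈τ)   → PΔτ b (inj₂ b∈τ) })
                         U'-keeps
    bounded : ∀ a → a ∈TV⟨ applyEnv (U ∘ₛ U') (union BM.Θ BN.Θ) , (U ∘ₛ U') β ⟩ → P a
    bounded a (inj₂ a∈) = UU'-keeps β Pβ a a∈
    bounded a (inj₁ a∈) with b , b∈ , a∈Ub ← ∈TV-applyEnv⁻ a∈ =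
      UU'-keeps b ([ PΓμ b ∘ inj₁ , PΔτ b ∘ inj₁ ]′ (∈TV-union⁻ b∈)) a a∈Ub

⊢⇒⊩L : ∀ {Θ₀ M σ₀} → Θ₀ ⊢ M ∶ σ₀ → ∀ K → BoundedPrincipal K M
⊢⇒⊩L (⊢var x _) K = record { L = suc K ; K≤L = n≤1+n K ; ⊩M = var x K (λ _ → refl) refl ; bounded = bounded }
  where
  bounded : ∀ a → a ∈TV⟨ singleton x (tvar K) , tvar K ⟩ → InRange K (suc K) a
  bounded a (inj₁ (y , t , x:K , a∈t)) with refl , refl ← singleton-just⁻ x:K | here ← a∈t = ≤-refl , ≤-refl
  bounded a (inj₂ here) = ≤-refl , ≤-refl
⊢⇒⊩L (⊢lam {μ = μ₀} Γ₀0 _ ⊢M) K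
  with B ← ⊢⇒⊩L ⊢M K
  with S , Γ₀≗ , _ ← ⊩L-principal (BoundedPrincipal.⊩M B) ⊢M
  with BoundedPrincipal.Θ B 0 in Γ0≡ | ≡.trans (≡.sym Γ₀0) (Γ₀≗ 0)
... | nothing | ()
... | just μ  | _ = record
  { L       = B.L
  ; K≤L     = B.K≤L
  ; ⊩M      = lam (⊢-dom⊆FV ⊢M Γ₀0) B.⊩M Γ0≡ (λ _ → refl) refl
  ; bounded = λ { a (inj₁ (y , t , Γy≡t , a∈t)) → B.bounded a (inj₁ (suc y , t , Γy≡t , a∈t))
                ; a (inj₂ (left a∈μ))           → B.bounded a (inj₁ (0 , μ , Γ0≡ , a∈μ))
                ; a (inj₂ (right a∈ν))          → B.bounded a (inj₂ a∈ν) }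
  }
  where module B = BoundedPrincipal B
⊢⇒⊩L (⊢app Γ₀#Δ₀ _ ⊢M ⊢N) K =
  boundedPrincipal-app BM BN (proj₂ (⊩L-principal (BoundedPrincipal.⊩M BM) ⊢M))
                             (proj₂ (⊩L-principal (BoundedPrincipal.⊩M BN) ⊢N)) Γ₀#Δ₀
  where
  BM : BoundedPrincipal K _
  BM = ⊢⇒⊩L ⊢M K
  BN : BoundedPrincipal (BoundedPrincipal.L BM) _
  BN = ⊢⇒⊩L ⊢N (BoundedPrincipal.L BM)

-- Principal typings are unique up to renaming

⊩L-resp : ∀ {Θ Θ' M σ σ'} → Θ ≗ Θ' → σ ≡ σ' → Θ ⊩L M ∶ σ → Θ' ⊩L M ∶ σ'
⊩L-resp Θ≗Θ' refl (var x a Θ≗ σ≡) = var x a (λ y → ≡.trans (≡.sym (Θ≗Θ' y)) (Θ≗ y)) σ≡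
⊩L-resp Θ≗Θ' refl (lam occ ⊩M Γ0 Θ≗ σ≡) = lam occ ⊩M Γ0 (λ y → ≡.trans (≡.sym (Θ≗Θ' y)) (Θ≗ y)) σ≡
⊩L-resp Θ≗Θ' refl (app α β U' U ⊩M ⊩N Γ#Δ disjointTV α≢β α∉Γμ α∉Δτ β∉Γμ β∉Δτ m₁ m₂ Θ≗ σ≡) =
  app α β U' U ⊩M ⊩N Γ#Δ disjointTV α≢β α∉Γμ α∉Δτ β∉Γμ β∉Δτ m₁ m₂ (λ y → ≡.trans (≡.sym (Θ≗Θ' y)) (Θ≗ y)) σ≡

transpose : ℕ → ℕ → ℕ → ℕ
transpose b c x with x ≟ℕ b | x ≟ℕ c
... | yes _ | _     = c
... | no _  | yes _ = b
... | no _  | no _  = x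

transpose-other : ∀ {b c x} → x ≢ b → x ≢ c → transpose b c x ≡ x
transpose-other {b} {c} {x} x≢b x≢c with x ≟ℕ b | x ≟ℕ c
... | yes x≡b | _       = ⊥-elim (x≢b x≡b)
... | no _    | yes x≡c = ⊥-elim (x≢c x≡c)
... | no _    | no _    = refl

transpose-left : ∀ b c → transpose b c b ≡ c
transpose-left b c with b ≟ℕ b
... | yes _  = refl
... | no b≢b = ⊥-elim (b≢b refl)

transpose-right : ∀ b c → transpose b c c ≡ b
transpose-right b c with c ≟ℕ b | c ≟ℕ c
... | yes c≡b | _      = c≡b
... | no _    | yes _  = refl
... | no _    | no c≢c = ⊥-elim (c≢c refl)

transpose-involutive : ∀ b c x → transpose b c (transpose b c x) ≡ x
transpose-involutive b c x with x ≟ℕ b | x ≟ℕ c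
... | yes refl | _        = transpose-right x c
... | no x≢b   | yes refl = transpose-left b x
... | no x≢b   | no x≢c   = transpose-other x≢b x≢c

transposition : ℕ → ℕ → ℕ ↔ ℕ
transposition b c = mk↔ₛ′ (transpose b c) (transpose b c) (transpose-involutive b c) (transpose-involutive b c)

extend-injection : ∀ (Vs : List ℕ) (f : ℕ → ℕ) → (∀ {a a'} → a ∈ Vs → a' ∈ Vs → f a ≡ f a' → a ≡ a') →
                   ∃ λ (π : ℕ ↔ ℕ) → ∀ a → a ∈ Vs → Inverse.to π a ≡ f a
extend-injection []       f f-inj = ↔-refl , λ _ ()
extend-injection (b ∷ Vs) f f-inj
  with π , π≗f ← extend-injection Vs f (λ a∈ a'∈ → f-inj (there a∈) (there a'∈)) =
  ↔-trans π (transposition (f b) (Inverse.to π b)) , agrees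
  where
  agrees : ∀ a → a ∈ b ∷ Vs → transpose (f b) (Inverse.to π b) (Inverse.to π a) ≡ f a
  agrees a a∈ with a ≟ℕ b
  ... | yes refl = transpose-right (f a) (Inverse.to π a)
  agrees a (here a≡b) | no a≢b = ⊥-elim (a≢b a≡b)
  agrees a (there a∈Vs) | no a≢b = ≡.trans (transpose-other πa≢fb πa≢πb) (π≗f a a∈Vs)
    where
    πa≢fb : Inverse.to π a ≢ f b
    πa≢fb eq = a≢b (f-inj (there a∈Vs) (here refl) (≡.trans (≡.sym (π≗f a a∈Vs)) eq))
    πa≢πb : Inverse.to π a ≢ Inverse.to π b
    πa≢πb eq = a≢b (≡.trans (≡.sym (Inverse.strictlyInverseʳ π a))
                            (≡.trans (cong (Inverse.from π) eq) (Inverse.strictlyInverseʳ π b)))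

applyT≡tvar⁻ : ∀ {S a} u → applyT S u ≡ tvar a → ∃ λ b → u ≡ tvar b
applyT≡tvar⁻ (tvar b) _ = b , refl

-- The variable of a type variable.
tvarIndex : Ty → ℕ
tvarIndex (tvar b) = b
tvarIndex (_ ⇒ _)  = 0

roundTrip : ∀ {S T a} t → applyT S (applyT T t) ≡ t → a occursIn t → applyT S (T a) ≡ tvar a
roundTrip {S} {T} t STt≡t = applyT-fixed⇒identity t (≡.trans (applyT-∘ S T t) STt≡t)

instance-roundTrip : ∀ {S T Γ σ Γ' σ'} → IsInstance T Γ σ Γ' σ' → IsInstance S Γ' σ' Γ σ →
                     ∀ a → a ∈TV⟨ Γ , σ ⟩ → applyT S (T a) ≡ tvar a
instance-roundTrip {S} {T} (_ , σ'≡) (_ , σ≡) a (inj₂ a∈σ) =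
  roundTrip _ (≡.sym (≡.trans σ≡ (cong (applyT S) σ'≡))) a∈σ
instance-roundTrip {S} {T} {Γ} {Γ' = Γ'} (Γ'≗ , _) (Γ≗ , _) a (inj₁ (x , t , Γx≡t , a∈t)) =
  roundTrip t (just-injective (begin
    just (applyT S (applyT T t))                      ≡⟨ cong (mapMaybe (applyT S) ∘ mapMaybe (applyT T)) Γx≡t ⟨
    mapMaybe (applyT S) (mapMaybe (applyT T) (Γ x))   ≡⟨ cong (mapMaybe (applyT S)) (Γ'≗ x) ⟨
    mapMaybe (applyT S) (Γ' x)                        ≡⟨ Γ≗ x ⟨
    Γ x                                               ≡⟨ Γx≡t ⟩
    just t                                            ∎)) a∈t
  where open ≡.≡-Reasoning

mutualInstances⇒renaming : ∀ {S T Γ σ Γ' σ'} Vs → (∀ a → a ∈TV⟨ Γ , σ ⟩ ⇔ a ∈ Vs) →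
                           IsInstance T Γ σ Γ' σ' → IsInstance S Γ' σ' Γ σ →
                           ∃ λ (π : ℕ ↔ ℕ) → IsInstance (tvar ∘ Inverse.to π) Γ σ Γ' σ'
mutualInstances⇒renaming {S} {T} {Γ} {σ} Vs Vs⇔ (Γ'≗ , σ'≡) S-inst =
  π , (λ x → ≡.trans (Γ'≗ x) (applyEnv-cong Γ (λ a → T≗π ∘ to (Vs⇔ a) ∘ inj₁) x)) ,
      ≡.trans σ'≡ (applyT-cong σ λ a → T≗π ∘ to (Vs⇔ a) ∘ inj₂)
  where
  ST≗id : ∀ {a} → a ∈ Vs → applyT S (T a) ≡ tvar a
  ST≗id {a} a∈ = instance-roundTrip (Γ'≗ , σ'≡) S-inst a (from (Vs⇔ a) a∈)
  f : ℕ → ℕ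
  f a = tvarIndex (T a)
  Ta≡f : ∀ {a} → a ∈ Vs → T a ≡ tvar (f a)
  Ta≡f {a} a∈ with T a | applyT≡tvar⁻ (T a) (ST≗id a∈)
  ... | _ | b , refl = refl
  Sf≡ : ∀ {a} → a ∈ Vs → S (f a) ≡ tvar a
  Sf≡ a∈ = ≡.trans (cong (applyT S) (≡.sym (Ta≡f a∈))) (ST≗id a∈)
  f-injective : ∀ {a a'} → a ∈ Vs → a' ∈ Vs → f a ≡ f a' → a ≡ a'
  f-injective a∈ a'∈ fa≡fa' = tvar-injective (≡.trans (≡.sym (Sf≡ a∈)) (≡.trans (cong S fa≡fa') (Sf≡ a'∈)))
  π : ℕ ↔ ℕ
  π = proj₁ (extend-injection Vs f f-injective)
  T≗π : ∀ {a} → a ∈ Vs → T a ≡ tvar (Inverse.to π a)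
  T≗π {a} a∈ = ≡.trans (Ta≡f a∈) (cong tvar (≡.sym (proj₂ (extend-injection Vs f f-injective) a a∈)))

mainTheorem6 : ∀ {M M' : Term} {Γ : Env} {σ : Ty} →
    Linear M → M =βL M' → Γ ⊩L M ∶ σ →
    Σ (ℕ → ℕ) λ ρ → Σ (ℕ → ℕ) λ ρ⁻ →
      (∀ a → ρ⁻ (ρ a) ≡ a) × (∀ a → ρ (ρ⁻ a) ≡ a) ×
      ((λ x → mapMaybe (renameT ρ) (Γ x)) ⊩L M' ∶ renameT ρ σ)
mainTheorem6 {M' = M'} {Γ} {σ} _ M=M' ⊩M
  with ⊢M ← ⊩L⇒⊢ ⊩M
  with ⊢M' ← to (⊢-resp-=βL M=M') ⊢M
  with record { ⊩M = ⊩M' } ← ⊢⇒⊩L ⊢M' 0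
  with _ , M'-instance ← ⊩L-principal ⊩M (from (⊢-resp-=βL M=M') (⊩L⇒⊢ ⊩M'))
  with _ , M-instance  ← ⊩L-principal ⊩M' ⊢M'
  with Vs , Vs⇔ ← ⊢-tyVars ⊢M
  with π , Γ'≗ , σ'≡ ← mutualInstances⇒renaming Vs Vs⇔ M'-instance M-instance =
  Inverse.to π , Inverse.from π , Inverse.strictlyInverseʳ π , Inverse.strictlyInverseˡ π ,
  ⊩L-resp Γ'≗ σ'≡ ⊩M'
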